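{- Let $\nu\geq 2$ be an integer, let $\mathbf{c}=(c_\nu,\ldots,c_1)\in\mathbb{Z}^{\nu}$ be a fixed non-zero vector and let $P(x)=c_{\nu}x^{\nu}+\cdots+c_1x$ have non-zero discriminant. Then the sequence $(\mathcal{F}_{Q,P})_{Q\geq 1}$ is uniformly distributed modulo one, i.e. the discrepancy $D_{\mathcal{N}_{Q,P}}(\mathcal{F}_{Q,P})\to0$ as $Q\to\infty$.
   Context: $\mathcal{F}_{Q,P}=\{a/q: 1\leq a\leq q\leq Q,\ \gcd(P(a),q)=1\}$, $\mathcal{N}_{Q,P}=\#\mathcal{F}_{Q,P}$. For $N$ points in $[0,1]$, with $A(\alpha;N)$ the number of points $\le\alpha$, the discrepancy is $\sup_{0\le\alpha\le1}|A(\alpha;N)/N-\alpha|$.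
   Formalization: In the discrepancy α ranges over the rationals in [0,1], and the limit $D_{\mathcal{N}_{Q,P}}(\mathcal{F}_{Q,P})\to0$ is expressed only with rational tolerances. -}

module Defs where

open import Data.Nat as ℕ using (ℕ; zero; suc; _∸_; _≤?_)
open import Data.Nat.GCD using (gcd)
open import Data.Integer as ℤ using (ℤ; +_; -[1+_]; +[1+_]; 0ℤ; 1ℤ)
open import Data.Integer.DivMod using () renaming (_/_ to _div_)
open import Data.Rational as ℚ using (ℚ)
open import Data.Rational.Properties as ℚP using ()
open import Data.Fin using (Fin; toℕ; punchIn)
open import Data.Fin.Base as Fin using ()
open import Data.List using (List; []; _∷_; map; foldr; reverse; length; filter; concatMap; upTo; allFin; sum)
open import Data.Bool using (Bool; true; false; if_then_else_; _∧_)
open import Data.Product using (_×_; _,_)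
open import Relation.Nullary.Decidable using (⌊_⌋)
open import Relation.Nullary using (yes; no)

-- Integer polynomials as coefficient lists in INCREASING degree:
-- [a₀, a₁, …, a_d] represents a₀ + a₁ x + … + a_d x^d.

Poly : Set
Poly = List ℤ

-- P(x) = c_ν x^ν + … + c₁ x, where c i is the coefficient of x^(toℕ i + 1).
poly : ∀ {ν} → (Fin ν → ℤ) → Poly
poly c = 0ℤ ∷ map c (allFin _)

eval : Poly → ℤ → ℤ
eval p x = foldr (λ a acc → a ℤ.+ x ℤ.* acc) 0ℤ p

isZero : ℤ → Bool
isZero (+ zero) = true
isZero _        = false

dropZeros : List ℤ → List ℤ
dropZeros []       = []
dropZeros (a ∷ as) = if isZero a then dropZeros as else a ∷ as

trim : Poly → Poly
trim p = reverse (dropZeros (reverse p))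

coeff : Poly → ℕ → ℤ
coeff []       _       = 0ℤ
coeff (a ∷ _)  zero    = a
coeff (_ ∷ as) (suc k) = coeff as k

derivFrom : ℕ → Poly → Poly
derivFrom k []       = []
derivFrom k (a ∷ as) = (+ k) ℤ.* a ∷ derivFrom (suc k) as

deriv : Poly → Poly
deriv []       = []
deriv (_ ∷ as) = derivFrom 1 as

sgn : ℕ → ℤ
sgn zero          = 1ℤ
sgn (suc zero)    = ℤ.- 1ℤ
sgn (suc (suc k)) = sgn k

det : ∀ n → (Fin n → Fin n → ℤ) → ℤ
det zero    M = 1ℤ
det (suc n) M =
  foldr ℤ._+_ 0ℤ
    (map (λ j → sgn (toℕ j) ℤ.* M Fin.zero j ℤ.* det n (λ r k → M (Fin.suc r) (punchIn j k)))
         (allFin (suc n)))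

-- Sylvester matrix and resultant of f (degree m) and g (degree n),
-- given as trimmed coefficient lists with the stated degrees.

sylEntry : Poly → ℕ → Poly → ℕ → ℕ → ℕ → ℤ
sylEntry f m g n i j with ⌊ n ≤? i ⌋
... | false = if ⌊ i ≤? j ⌋ ∧ ⌊ j ∸ i ≤? m ⌋ then coeff f (m ∸ (j ∸ i)) else 0ℤ
... | true  = let k = i ∸ n in
              if ⌊ k ≤? j ⌋ ∧ ⌊ j ∸ k ≤? n ⌋ then coeff g (n ∸ (j ∸ k)) else 0ℤ

resultantDeg : Poly → ℕ → Poly → ℕ → ℤ
resultantDeg f m g n = det (m ℕ.+ n) (λ i j → sylEntry f m g n (toℕ i) (toℕ j))

degree : Poly → ℕ
degree p = length (trim p) ∸ 1

lead : Poly → ℤ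
lead p = coeff (trim p) (degree p)

-- Disc(P) = (-1)^(d(d-1)/2) · Res(P, P') / lead(P), d = deg P.
-- (For the zero polynomial we set it to 0.)
discriminant : Poly → ℤ
discriminant p with lead p
... | + zero   = 0ℤ
... | a@(+[1+ _ ]) = body a
  where d = degree p
        body : (l : ℤ) → .{{_ : ℤ.NonZero l}} → ℤ
        body l = sgn (d ℕ.* (d ∸ 1) ℕ./ 2) ℤ.* (resultantDeg (trim p) d (trim (deriv (trim p))) (d ∸ 1) div l)
... | a@(-[1+ _ ]) = body a
  where d = degree p
        body : (l : ℤ) → .{{_ : ℤ.NonZero l}} → ℤ
        body l = sgn (d ℕ.* (d ∸ 1) ℕ./ 2) ℤ.* (resultantDeg (trim p) d (trim (deriv (trim p))) (d ∸ 1) div l)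

-- The set F_{Q,P} = { a/q : 1 ≤ a ≤ q ≤ Q, gcd(P(a), q) = 1 },
-- listed as pairs (a , q).  (Since P(0) = 0, a ∣ P(a), so the
-- condition forces gcd(a,q)=1: the fractions are distinct.)

from1 : ℕ → List ℕ
from1 n = map suc (upTo n)

coprimeP : Poly → ℕ → ℕ → Bool
coprimeP P a q = ⌊ gcd ℤ.∣ eval P (+ a) ∣ q ℕ.≟ 1 ⌋

pairs : ℕ → List (ℕ × ℕ)
pairs Q = concatMap (λ q → map (λ a → a , q) (from1 q)) (from1 Q)

countIf : ∀ {A : Set} → (A → Bool) → List A → ℕ
countIf p []       = 0
countIf p (x ∷ xs) = if p x then suc (countIf p xs) else countIf p xs

-- value a/q of a pair (q = 0 never occurs in pairs Q)
val : ℕ × ℕ → ℚ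
val (a , zero)  = ℚ.0ℚ
val (a , suc k) = (+ a) ℚ./ suc k

inF : Poly → ℕ × ℕ → Bool
inF P (a , q) = coprimeP P a q

𝒩 : Poly → ℕ → ℕ
𝒩 P Q = countIf (inF P) (pairs Q)

A : Poly → ℕ → ℚ → ℕ
A P Q α = countIf (λ x → inF P x ∧ ⌊ val x ℚP.≤? α ⌋) (pairs Q)

-- k / N as a rational (N = 0 gives 0; irrelevant since 𝒩 ≥ 1 for Q ≥ 1)
ratio : ℕ → ℕ → ℚ
ratio k zero    = ℚ.0ℚ
ratio k (suc n) = (+ k) ℚ./ suc n

localDisc : Poly → ℕ → ℚ → ℚ
localDisc P Q α = ℚ.∣ ratio (A P Q α) (𝒩 P Q) ℚ.- α ∣

-- Write α = n/d and ε ≥ 1/E, and call (a, q) L-good when gcd(P(a), q) is coprime to L. Being L-good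
-- is L-periodic in a, so for every q the L-good a ≤ αq make up an α-fraction of the L-good a ≤ q,
-- up to O(L). Take L = z!·|cⱼ| for a nonzero coefficient cⱼ. An L-good pair with gcd(P(a), q) > 1
-- has a prime p > z with p ∤ cⱼ dividing q and P(a); by Lagrange's theorem P has at most deg P
-- roots in every window of p consecutive integers, so there are at most
-- deg P · Σ_{p>z} (Q/p)² + O(Q log Q) ≤ deg P · Q²/z + o(Q²) such pairs. The same sieve, applied to
-- the moduli q ≡ 1 (mod p₀!·|cⱼ|), shows 𝒩_{Q,P} ≫ Q², so for z large the error is at most 𝒩_{Q,P}/E.
-- Only the nonvanishing of one coefficient is used.

module Submission where

open import Defs
open import Data.Nat using (ℕ; _≤_)
open import Data.Integer using (ℤ; 0ℤ)
open import Data.Rational using (ℚ; 0ℚ; 1ℚ) renaming (_≤_ to _≤ℚ_; _<_ to _<ℚ_)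
open import Data.Fin using (Fin)
open import Data.Product using (∃; ∃-syntax)
open import Relation.Binary.PropositionalEquality using (_≢_)
open import Data.Integer using (+0; +[1+_]; -[1+_]; +<+)
open import Data.Rational using (mkℚ; *<*)
open import Data.Product using (_,_)

module Sums where

  open import Data.Nat using (zero; suc; _+_; _*_; _∸_; _<_; z≤n; s≤s)
  open import Data.Nat.Properties
  open import Algebra.Properties.CommutativeSemigroup +-commutativeSemigroup using (interchange)
  open import Data.Bool using (Bool; true; false; _∧_)
  open import Function using (_∘_)
  open import Relation.Nullary using (yes; no)
  open import Relation.Binary.PropositionalEquality
    using (_≡_; refl; sym; trans; cong; cong₂; module ≡-Reasoning)

  ∑ : (ℕ → ℕ) → ℕ → ℕ
  ∑ f zero    = 0
  ∑ f (suc n) = ∑ f n + f n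

  𝟙 : Bool → ℕ
  𝟙 true  = 1
  𝟙 false = 0

  𝟙≤1 : ∀ b → 𝟙 b ≤ 1
  𝟙≤1 true  = s≤s z≤n
  𝟙≤1 false = z≤n

  𝟙-∧-≤ˡ : ∀ b c → 𝟙 (b ∧ c) ≤ 𝟙 b
  𝟙-∧-≤ˡ true  c = 𝟙≤1 c
  𝟙-∧-≤ˡ false c = z≤n

  𝟙-∧-≤ʳ : ∀ b c → 𝟙 (b ∧ c) ≤ 𝟙 c
  𝟙-∧-≤ʳ true  c = ≤-refl
  𝟙-∧-≤ʳ false c = z≤n

  ∑-front : ∀ f n → ∑ f (suc n) ≡ f 0 + ∑ (f ∘ suc) n
  ∑-front f zero    = +-comm 0 (f 0)
  ∑-front f (suc n) = begin
    ∑ f (suc n) + f (suc n)             ≡⟨ cong (_+ f (suc n)) (∑-front f n) ⟩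
    f 0 + ∑ (f ∘ suc) n + f (suc n)     ≡⟨ +-assoc (f 0) _ _ ⟩
    f 0 + (∑ (f ∘ suc) n + f (suc n))   ∎
    where open ≡-Reasoning

  ∑-cong : ∀ {f g} n → (∀ i → i < n → f i ≡ g i) → ∑ f n ≡ ∑ g n
  ∑-cong zero    f≡g = refl
  ∑-cong (suc n) f≡g = cong₂ _+_ (∑-cong n (λ i i<n → f≡g i (m<n⇒m<1+n i<n))) (f≡g n ≤-refl)

  ∑-mono : ∀ {f g} n → (∀ i → i < n → f i ≤ g i) → ∑ f n ≤ ∑ g n
  ∑-mono zero    f≤g = z≤n
  ∑-mono (suc n) f≤g = +-mono-≤ (∑-mono n (λ i i<n → f≤g i (m<n⇒m<1+n i<n))) (f≤g n ≤-refl)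

  ∑-+ : ∀ f g n → ∑ (λ i → f i + g i) n ≡ ∑ f n + ∑ g n
  ∑-+ f g zero    = refl
  ∑-+ f g (suc n) = trans (cong (_+ (f n + g n)) (∑-+ f g n)) (interchange (∑ f n) (∑ g n) (f n) (g n))

  ∑-* : ∀ k f n → ∑ (λ i → k * f i) n ≡ k * ∑ f n
  ∑-* k f zero    = sym (*-zeroʳ k)
  ∑-* k f (suc n) = trans (cong (_+ k * f n) (∑-* k f n)) (sym (*-distribˡ-+ k (∑ f n) (f n)))

  ∑-const : ∀ k n → ∑ (λ _ → k) n ≡ n * k
  ∑-const k zero    = refl
  ∑-const k (suc n) = trans (cong (_+ k) (∑-const k n)) (+-comm (n * k) k)

  ∑-zero : ∀ f n → (∀ i → i < n → f i ≡ 0) → ∑ f n ≡ 0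
  ∑-zero f n f≡0 = trans (∑-cong n f≡0) (trans (∑-const 0 n) (*-zeroʳ n))

  ∑-≤-const : ∀ f k n → (∀ i → i < n → f i ≤ k) → ∑ f n ≤ n * k
  ∑-≤-const f k n f≤k = ≤-trans (∑-mono n f≤k) (≤-reflexive (∑-const k n))

  ∑𝟙≤ : ∀ (b : ℕ → Bool) n → ∑ (𝟙 ∘ b) n ≤ n
  ∑𝟙≤ b n = ≤-trans (∑-≤-const _ 1 n (λ i _ → 𝟙≤1 (b i))) (≤-reflexive (*-identityʳ n))

  ∑-split : ∀ f m n → ∑ f (m + n) ≡ ∑ f m + ∑ (λ i → f (m + i)) n
  ∑-split f m zero    = trans (cong (∑ f) (+-identityʳ m)) (sym (+-identityʳ _))
  ∑-split f m (suc n) = begin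
    ∑ f (m + suc n)                                ≡⟨ cong (∑ f) (+-suc m n) ⟩
    ∑ f (m + n) + f (m + n)                        ≡⟨ cong (_+ f (m + n)) (∑-split f m n) ⟩
    ∑ f m + ∑ (λ i → f (m + i)) n + f (m + n)      ≡⟨ +-assoc (∑ f m) _ _ ⟩
    ∑ f m + ∑ (λ i → f (m + i)) (suc n)            ∎
    where open ≡-Reasoning

  ∑-split-≤ : ∀ f {m n} → m ≤ n → ∑ f n ≡ ∑ f m + ∑ (λ i → f (m + i)) (n ∸ m)
  ∑-split-≤ f {m} m≤n = trans (cong (∑ f) (sym (m+[n∸m]≡n m≤n))) (∑-split f m _)

  ∑-monoˡ : ∀ f {m n} → m ≤ n → ∑ f m ≤ ∑ f n
  ∑-monoˡ f m≤n = ≤-trans (m≤m+n _ _) (≤-reflexive (sym (∑-split-≤ f m≤n)))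

  term≤∑ : ∀ f {i n} → i < n → f i ≤ ∑ f n
  term≤∑ f {i} {suc n} i<1+n with i ≟ n
  ... | yes refl = m≤n+m (f n) (∑ f n)
  ... | no i≢n   = ≤-trans (term≤∑ f (≤∧≢⇒< (≤-pred i<1+n) i≢n)) (m≤m+n _ _)

  ∑-swap : ∀ (F : ℕ → ℕ → ℕ) m n → ∑ (λ i → ∑ (F i) m) n ≡ ∑ (λ j → ∑ (λ i → F i j) n) m
  ∑-swap F m zero    = sym (∑-zero _ m (λ _ _ → refl))
  ∑-swap F m (suc n) = begin
    ∑ (λ i → ∑ (F i) m) n + ∑ (F n) m                 ≡⟨ cong (_+ ∑ (F n) m) (∑-swap F m n) ⟩
    ∑ (λ j → ∑ (λ i → F i j) n) m + ∑ (F n) m         ≡⟨ sym (∑-+ _ (F n) m) ⟩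
    ∑ (λ j → ∑ (λ i → F i j) (suc n)) m               ∎
    where open ≡-Reasoning

  ∑-stride : ∀ F M → 1 ≤ M → ∀ T → ∑ (λ t → F (M * t)) T ≤ ∑ F (M * T)
  ∑-stride F M M≥1 zero    = ≤-reflexive (cong (∑ F) (sym (*-zeroʳ M)))
  ∑-stride F M M≥1 (suc T) = begin
    ∑ (λ t → F (M * t)) T + F (M * T)           ≤⟨ +-mono-≤ (∑-stride F M M≥1 T) F[MT]≤ ⟩
    ∑ F (M * T) + ∑ (λ j → F (M * T + j)) M     ≡⟨ sym (∑-split F (M * T) M) ⟩
    ∑ F (M * T + M)                             ≡⟨ cong (∑ F) (trans (+-comm (M * T) M) (sym (*-suc M T))) ⟩
    ∑ F (M * suc T)                             ∎
    where
    open ≤-Reasoning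
    F[MT]≤ : F (M * T) ≤ ∑ (λ j → F (M * T + j)) M
    F[MT]≤ = ≤-trans (≤-reflexive (cong F (sym (+-identityʳ _)))) (term≤∑ (λ j → F (M * T + j)) M≥1)

  ∑-swap₃ : ∀ (F : ℕ → ℕ → ℕ → ℕ) (len : ℕ → ℕ) n R →
            ∑ (λ i → ∑ (λ k → ∑ (λ m → F m i k) R) (len i)) n ≡ ∑ (λ m → ∑ (λ i → ∑ (F m i) (len i)) n) R
  ∑-swap₃ F len n R = trans (∑-cong n (λ i _ → ∑-swap (λ k m → F m i k) R (len i)))
                            (∑-swap (λ i m → ∑ (F m i) (len i)) R n)

module Arithmetic where

  open import Data.Nat using (zero; suc; _+_; _*_; _!; _/_; _%_; s≤s; NonZero)
  open import Data.Nat.Properties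
  open import Data.Nat.DivMod using (m≡m%n+[m/n]*n; m%n<n; m/n*n≤m; m*n/n≡m; /-monoˡ-≤)
  open import Data.Nat.Solver using (module +-*-Solver)
  open +-*-Solver using (solve; _:=_; _:+_; _:*_)
  open import Data.Nat.Divisibility using (_∣_; ∣-trans; m∣m*n; m≤n⇒m!∣n!)
  open import Data.Nat.Primality using (Prime)
  open import Data.Nat.Primality.Factorisation using (factorise)
  open import Data.Bool using (true; false)
  open import Data.List using (_∷_)
  open import Data.List.Relation.Unary.All using (_∷_)
  open import Data.Product using (_×_; _,_)
  open import Relation.Nullary using (Dec; yes; no; ¬_)
  open import Relation.Nullary.Decidable using (⌊_⌋)
  open import Relation.Binary.PropositionalEquality using (_≡_; refl; sym; subst; module ≡-Reasoning)
  open import Data.Empty using (⊥-elim)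

  ⌊⌋≡true⇒ : ∀ {A : Set} (a? : Dec A) → ⌊ a? ⌋ ≡ true → A
  ⌊⌋≡true⇒ (yes a) _ = a

  ⌊⌋≡true : ∀ {A : Set} (a? : Dec A) → A → ⌊ a? ⌋ ≡ true
  ⌊⌋≡true (yes _) _ = refl
  ⌊⌋≡true (no ¬a) a = ⊥-elim (¬a a)

  ⌊⌋≡false⇒¬ : ∀ {A : Set} (a? : Dec A) → ⌊ a? ⌋ ≡ false → ¬ A
  ⌊⌋≡false⇒¬ (no ¬a) _ = ¬a

  ∃primeFactor : ∀ n → 2 ≤ n → ∃[ p ] (Prime p × p ∣ n)
  ∃primeFactor (suc zero) (s≤s ())
  ∃primeFactor n@(suc (suc _)) _ with factorise n
  ... | record { factors = p ∷ _ ; isFactorisation = n≡∏ ; factorsPrime = p-prime ∷ _ } =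
    p , p-prime , subst (p ∣_) (sym n≡∏) (m∣m*n _)

  m∣n! : ∀ {m n} → 1 ≤ m → m ≤ n → m ∣ n !
  m∣n! {suc m} _ m<n = ∣-trans (m∣m*n (m !)) (m≤n⇒m!∣n! m<n)

  m*n≤o⇒m≤o/n : ∀ m n o .{{_ : NonZero n}} → m * n ≤ o → m ≤ o / n
  m*n≤o⇒m≤o/n m n o mn≤o = subst (_≤ o / n) (m*n/n≡m m n) (/-monoˡ-≤ n mn≤o)

  m≤o/n⇒m*n≤o : ∀ m n o .{{_ : NonZero n}} → m ≤ o / n → m * n ≤ o
  m≤o/n⇒m*n≤o m n o m≤o/n = ≤-trans (*-monoˡ-≤ n m≤o/n) (m/n*n≤m o n)

  n*[m/n]≤m : ∀ m n .{{_ : NonZero n}} → n * (m / n) ≤ m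
  n*[m/n]≤m m n = ≤-trans (≤-reflexive (*-comm n (m / n))) (m/n*n≤m m n)

  m≤n*[m/n]+n : ∀ m n .{{_ : NonZero n}} → m ≤ n * (m / n) + n
  m≤n*[m/n]+n m n = begin
    m                      ≡⟨ m≡m%n+[m/n]*n m n ⟩
    m % n + (m / n) * n    ≤⟨ +-monoˡ-≤ _ (<⇒≤ (m%n<n m n)) ⟩
    n + (m / n) * n        ≡⟨ solve 2 (λ n x → n :+ x :* n := n :* x :+ n) refl n (m / n) ⟩
    n * (m / n) + n        ∎
    where open ≤-Reasoning

module PairCounting where

  open import Data.Nat using (zero; suc; _+_)
  open import Data.Bool using (Bool; true; false; if_then_else_)
  open import Data.List using (List; []; _∷_; _++_; map; applyUpTo; upTo; concatMap)
  open import Data.List.Properties using (concatMap-map)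
  open import Data.Product using (_×_; _,_)
  open import Function using (_∘_)
  open import Relation.Binary.PropositionalEquality
    using (_≡_; refl; sym; cong; module ≡-Reasoning)
  open Sums

  countPairs : (ℕ → ℕ → Bool) → ℕ → ℕ
  countPairs φ Q = ∑ (λ i → ∑ (λ k → 𝟙 (φ (suc k) (suc i))) (suc i)) Q

  countIf-++ : ∀ {A : Set} (h : A → Bool) xs ys → countIf h (xs ++ ys) ≡ countIf h xs + countIf h ys
  countIf-++ h []       ys = refl
  countIf-++ h (x ∷ xs) ys with h x
  ... | true  = cong suc (countIf-++ h xs ys)
  ... | false = countIf-++ h xs ys

  countIf-map : ∀ {A B : Set} (h : B → Bool) (g : A → B) xs → countIf h (map g xs) ≡ countIf (h ∘ g) xs
  countIf-map h g []       = refl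
  countIf-map h g (x ∷ xs) with h (g x)
  ... | true  = cong suc (countIf-map h g xs)
  ... | false = countIf-map h g xs

  countIf-applyUpTo : ∀ {A : Set} (h : A → Bool) f n → countIf h (applyUpTo f n) ≡ ∑ (𝟙 ∘ h ∘ f) n
  countIf-applyUpTo h f zero    = refl
  countIf-applyUpTo h f (suc n) = begin
    countIf h (f 0 ∷ applyUpTo (f ∘ suc) n)   ≡⟨ cons (h (f 0)) ⟩
    𝟙 (h (f 0)) + countIf h (applyUpTo (f ∘ suc) n)
      ≡⟨ cong (𝟙 (h (f 0)) +_) (countIf-applyUpTo h (f ∘ suc) n) ⟩
    𝟙 (h (f 0)) + ∑ (𝟙 ∘ h ∘ f ∘ suc) n       ≡⟨ sym (∑-front (𝟙 ∘ h ∘ f) n) ⟩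
    ∑ (𝟙 ∘ h ∘ f) (suc n)                     ∎
    where
    open ≡-Reasoning
    rest = countIf h (applyUpTo (f ∘ suc) n)
    cons : ∀ b → (if b then suc rest else rest) ≡ 𝟙 b + rest
    cons true  = refl
    cons false = refl

  countIf-concatMap : ∀ {A B : Set} (h : B → Bool) (F : A → List B) f n →
    countIf h (concatMap F (applyUpTo f n)) ≡ ∑ (countIf h ∘ F ∘ f) n
  countIf-concatMap h F f zero    = refl
  countIf-concatMap h F f (suc n) = begin
    countIf h (F (f 0) ++ concatMap F (applyUpTo (f ∘ suc) n))
      ≡⟨ countIf-++ h (F (f 0)) _ ⟩
    countIf h (F (f 0)) + countIf h (concatMap F (applyUpTo (f ∘ suc) n))
      ≡⟨ cong (countIf h (F (f 0)) +_) (countIf-concatMap h F (f ∘ suc) n) ⟩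
    countIf h (F (f 0)) + ∑ (countIf h ∘ F ∘ f ∘ suc) n
      ≡⟨ sym (∑-front (countIf h ∘ F ∘ f) n) ⟩
    ∑ (countIf h ∘ F ∘ f) (suc n) ∎
    where open ≡-Reasoning

  countIf-pairs : (ψ : ℕ × ℕ → Bool) → ∀ Q → countIf ψ (pairs Q) ≡ countPairs (λ a q → ψ (a , q)) Q
  countIf-pairs ψ Q = begin
    countIf ψ (concatMap column (map suc (upTo Q)))   ≡⟨ cong (countIf ψ) (concatMap-map column suc (upTo Q)) ⟩
    countIf ψ (concatMap (column ∘ suc) (upTo Q))     ≡⟨ countIf-concatMap ψ (column ∘ suc) (λ i → i) Q ⟩
    ∑ (countIf ψ ∘ column ∘ suc) Q                    ≡⟨ ∑-cong Q (λ i _ → countIf-column (suc i)) ⟩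
    countPairs (λ a q → ψ (a , q)) Q                  ∎
    where
    open ≡-Reasoning
    column : ℕ → List (ℕ × ℕ)
    column q = map (_, q) (from1 q)
    countIf-column : ∀ q → countIf ψ (column q) ≡ ∑ (λ k → 𝟙 (ψ (suc k , q))) q
    countIf-column q = begin
      countIf ψ (map (_, q) (map suc (upTo q)))   ≡⟨ countIf-map ψ (_, q) (from1 q) ⟩
      countIf (λ a → ψ (a , q)) (map suc (upTo q)) ≡⟨ countIf-map _ suc (upTo q) ⟩
      countIf (λ k → ψ (suc k , q)) (upTo q)      ≡⟨ countIf-applyUpTo _ (λ k → k) q ⟩
      ∑ (λ k → 𝟙 (ψ (suc k , q))) q               ∎

module Polynomial where

  open import Data.Nat using (suc; s≤s)
  import Data.Nat.Divisibility as ℕ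
  open import Data.Nat.Primality using (Prime; euclidsLemma)
  open import Data.Integer using (+_; _+_; _*_; _-_; ∣_∣)
  open import Data.Integer.Properties using (abs-*)
  open import Data.Integer.Divisibility.Signed
    using (_∣_; divides; ∣⇒∣ᵤ; ∣ᵤ⇒∣; ∣m∣n⇒∣m+n; ∣m∣n⇒∣m-n; ∣m+n∣n⇒∣m; ∣n⇒∣m*n; ∣m⇒∣m*n; ∣m⇒∣-m; ∣-refl)
  open import Data.Integer.Solver using (module +-*-Solver)
  open +-*-Solver using (solve; _:=_; _:+_; _:*_; _:-_; :-_; con)
  open import Data.List using ([]; _∷_; length)
  open import Data.List.Relation.Unary.All using (All; []; _∷_)
  open import Data.List.Relation.Unary.AllPairs using (AllPairs; []; _∷_)
  open import Data.Sum using (_⊎_; inj₁; inj₂; [_,_]′)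
  open import Data.Product using (_×_; _,_)
  open import Data.Empty using (⊥-elim)
  open import Relation.Nullary using (¬_)
  open import Relation.Binary.PropositionalEquality using (_≡_; refl; sym; trans; cong; subst; module ≡-Reasoning)

  _∣0 : ∀ k → k ∣ 0ℤ
  k ∣0 = divides 0ℤ refl

  ∣m-n⇒∣n-m : ∀ {k} m n → k ∣ m - n → k ∣ n - m
  ∣m-n⇒∣n-m m n k∣m-n = subst (_ ∣_) (solve 2 (λ m n → :- (m :- n) := n :- m) refl m n) (∣m⇒∣-m k∣m-n)

  ∣m-n∣n⇒∣m : ∀ {k} m n → k ∣ m - n → k ∣ n → k ∣ m
  ∣m-n∣n⇒∣m m n k∣m-n k∣n = subst (_ ∣_) (solve 2 (λ m n → (m :- n) :+ n := m) refl m n) (∣m∣n⇒∣m+n k∣m-n k∣n)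

  eval-periodic : ∀ P x k → k ∣ eval P (x + k) - eval P x
  eval-periodic []      x k = k ∣0
  eval-periodic (b ∷ B) x k = subst (k ∣_) (sym difference)
      (∣m∣n⇒∣m+n (∣m⇒∣m*n u ∣-refl) (∣n⇒∣m*n x (eval-periodic B x k)))
    where
    u = eval B (x + k)
    v = eval B x
    difference : (b + (x + k) * u) - (b + x * v) ≡ k * u + x * (u - v)
    difference = solve 5 (λ b x k u v → (b :+ (x :+ k) :* u) :- (b :+ x :* v) := k :* u :+ x :* (u :- v))
                   refl b x k u v

  quot : Poly → ℤ → Poly
  quot []      r = []
  quot (b ∷ B) r = eval (b ∷ B) r ∷ quot B r

  length-quot : ∀ L r → length (quot L r) ≡ length L
  length-quot []      r = refl
  length-quot (b ∷ B) r = cong suc (length-quot B r)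

  eval-quot : ∀ L x r → x * eval L x - r * eval L r ≡ (x - r) * eval (quot L r) x
  eval-quot []      x r = solve 2 (λ x r → x :* con 0ℤ :- r :* con 0ℤ := (x :- r) :* con 0ℤ) refl x r
  eval-quot (b ∷ B) x r = begin
    x * (b + x * a) - r * (b + r * c)
      ≡⟨ solve 5 (λ x r b a c → x :* (b :+ x :* a) :- r :* (b :+ r :* c)
                     := (x :- r) :* (b :+ r :* c) :+ x :* (x :* a :- r :* c)) refl x r b a c ⟩
    (x - r) * (b + r * c) + x * (x * a - r * c)
      ≡⟨ cong (λ y → (x - r) * (b + r * c) + x * y) (eval-quot B x r) ⟩
    (x - r) * (b + r * c) + x * ((x - r) * w)
      ≡⟨ solve 5 (λ x r b c w → (x :- r) :* (b :+ r :* c) :+ x :* ((x :- r) :* w)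
                     := (x :- r) :* ((b :+ r :* c) :+ x :* w)) refl x r b c w ⟩
    (x - r) * ((b + r * c) + x * w) ∎
    where
    open ≡-Reasoning
    a = eval B x
    c = eval B r
    w = eval (quot B r) x

  quot-∣⇒∣ : ∀ {k} L r → All (k ∣_) (quot L r) → All (k ∣_) L × k ∣ eval L r
  quot-∣⇒∣ []      r []       = [] , _ ∣0
  quot-∣⇒∣ (b ∷ B) r (k∣Lr ∷ k∣quot) with quot-∣⇒∣ B r k∣quot
  ... | k∣B , k∣Br = ∣m+n∣n⇒∣m k∣Lr (∣n⇒∣m*n r k∣Br) ∷ k∣B , k∣Lr

  euclidsLemmaℤ : ∀ {p} → Prime p → ∀ a b → + p ∣ a * b → (+ p ∣ a) ⊎ (+ p ∣ b)
  euclidsLemmaℤ p-prime a b p∣ab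
    with euclidsLemma ∣ a ∣ ∣ b ∣ p-prime (subst (_ ℕ.∣_) (abs-* a b) (∣⇒∣ᵤ p∣ab))
  ... | inj₁ p∣a = inj₁ (∣ᵤ⇒∣ p∣a)
  ... | inj₂ p∣b = inj₂ (∣ᵤ⇒∣ p∣b)

  module Lagrange {p : ℕ} (p-prime : Prime p) where

    Distinct : ℤ → ℤ → Set
    Distinct u v = ¬ (+ p ∣ v - u)

    Root : Poly → ℤ → Set
    Root P r = + p ∣ eval P r

    root-quot : ∀ a P r s → Root (a ∷ P) s → Root (a ∷ P) r → Distinct r s → Root (quot P r) s
    root-quot a P r s s-root r-root r≢s =
      [ (λ p∣s-r → ⊥-elim (r≢s p∣s-r)) , (λ p∣quot → p∣quot) ]′ (euclidsLemmaℤ p-prime (s - r) _ p∣product)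
      where
      difference : eval (a ∷ P) s - eval (a ∷ P) r ≡ s * eval P s - r * eval P r
      difference = solve 5 (λ a s r e f → (a :+ s :* e) :- (a :+ r :* f) := s :* e :- r :* f)
                     refl a s r (eval P s) (eval P r)
      p∣product : + p ∣ (s - r) * eval (quot P r) s
      p∣product = subst (+ p ∣_) (trans difference (eval-quot P s r)) (∣m∣n⇒∣m-n s-root r-root)

    roots-quot : ∀ a P r ss → All (Distinct r) ss → All (Root (a ∷ P)) ss → Root (a ∷ P) r →
                 All (Root (quot P r)) ss
    roots-quot a P r []       []           []             r-root = []
    roots-quot a P r (s ∷ ss) (r≢s ∷ r≢ss) (s-root ∷ ss-roots) r-root =
      root-quot a P r s s-root r-root r≢s ∷ roots-quot a P r ss r≢ss ss-roots r-root

    lagrange : ∀ P rs → length P ≤ length rs → AllPairs Distinct rs → All (Root P) rs → All (+ p ∣_) P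
    lagrange []      rs       _           _               _                   = []
    lagrange (a ∷ P) (r ∷ rs) (s≤s |P|≤) (r≢rs ∷ distinct) (r-root ∷ rs-roots) =
      p∣a (quot-∣⇒∣ P r (lagrange (quot P r) rs |quot|≤ distinct (roots-quot a P r rs r≢rs rs-roots r-root)))
      where
      |quot|≤ : length (quot P r) ≤ length rs
      |quot|≤ = subst (_≤ length rs) (sym (length-quot P r)) |P|≤
      p∣a : All (+ p ∣_) P × Root P r → All (+ p ∣_) (a ∷ P)
      p∣a (p∣P , p∣Pr) = ∣m+n∣n⇒∣m r-root (∣n⇒∣m*n r p∣Pr) ∷ p∣P

module RootCounting where

  open import Data.Nat using (zero; suc; _+_; _*_; _∸_; _<_; z≤n; s≤s; _≤?_; >-nonZero)
  open import Data.Nat.Properties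
  import Data.Nat.Divisibility as ℕ
  open import Data.Nat.Primality using (Prime)
  open import Data.Integer using (+_; ∣_∣)
  open import Data.Integer.Properties using (m-n≡m⊖n; ⊖-≥)
  open import Data.Integer.Divisibility.Signed using (_∣_; ∣⇒∣ᵤ)
  open import Data.List using (List; []; _∷_; length; map)
  open import Data.List.Properties using (length-map)
  open import Data.List.Relation.Unary.All as All using (All; []; _∷_)
  open import Data.List.Relation.Unary.All.Properties using (map⁺; Any¬⇒¬All)
  open import Data.List.Relation.Unary.Any using (Any)
  open import Data.List.Relation.Unary.AllPairs using (AllPairs; []; _∷_)
  open import Data.Bool using (Bool; true; false; if_then_else_)
  open import Data.Product using (_×_; _,_; proj₁)
  open import Data.Empty using (⊥-elim)
  open import Relation.Nullary using (¬_; yes; no)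
  open import Relation.Binary.PropositionalEquality
    using (_≡_; refl; sym; trans; cong; cong₂; subst; module ≡-Reasoning)
  open import Function using (_∘_)
  open Sums
  open Polynomial

  select : (ℕ → Bool) → ℕ → ℕ → List ℕ
  select h s zero    = []
  select h s (suc n) = if h s then s ∷ select h (suc s) n else select h (suc s) n

  length-select : ∀ h s n → length (select h s n) ≡ ∑ (λ i → 𝟙 (h (s + i))) n
  length-select h s zero    = refl
  length-select h s (suc n) = begin
    length (if h s then s ∷ rest else rest)           ≡⟨ length-if-∷ (h s) ⟩
    𝟙 (h s) + length rest                             ≡⟨ cong₂ _+_ (cong (𝟙 ∘ h) (sym (+-identityʳ s))) length-rest ⟩
    𝟙 (h (s + 0)) + ∑ (λ i → 𝟙 (h (s + suc i))) n    ≡⟨ sym (∑-front _ n) ⟩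
    ∑ (λ i → 𝟙 (h (s + i))) (suc n)                   ∎
    where
    open ≡-Reasoning
    rest = select h (suc s) n
    length-if-∷ : ∀ b → length (if b then s ∷ rest else rest) ≡ 𝟙 b + length rest
    length-if-∷ true  = refl
    length-if-∷ false = refl
    length-rest : length rest ≡ ∑ (λ i → 𝟙 (h (s + suc i))) n
    length-rest = trans (length-select h (suc s) n) (∑-cong n (λ i _ → cong (𝟙 ∘ h) (sym (+-suc s i))))

  select-sound : ∀ h s n → All (λ u → h u ≡ true) (select h s n)
  select-sound h s zero    = []
  select-sound h s (suc n) with h s in hs
  ... | true  = hs ∷ select-sound h (suc s) n
  ... | false = select-sound h (suc s) n

  InWindow : ℕ → ℕ → ℕ → Set
  InWindow s n u = s ≤ u × u < s + n

  InWindow-suc : ∀ {s n u} → InWindow (suc s) n u → InWindow s (suc n) u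
  InWindow-suc {s} {n} (s<u , u<) = ≤-trans (n≤1+n s) s<u , ≤-trans u< (≤-reflexive (sym (+-suc s n)))

  select-inWindow : ∀ h s n → All (InWindow s n) (select h s n)
  select-inWindow h s zero    = []
  select-inWindow h s (suc n) with h s
  ... | true  = (≤-refl , m<m+n s (s≤s z≤n)) ∷ All.map InWindow-suc (select-inWindow h (suc s) n)
  ... | false = All.map InWindow-suc (select-inWindow h (suc s) n)

  select-increasing : ∀ h s n → AllPairs _<_ (select h s n)
  select-increasing h s zero    = []
  select-increasing h s (suc n) with h s
  ... | true  = All.map proj₁ (select-inWindow h (suc s) n) ∷ select-increasing h (suc s) n
  ... | false = select-increasing h (suc s) n

  module _ {p : ℕ} (p-prime : Prime p) where
    open Lagrange p-prime

    inWindow-distinct : ∀ {s n u v} → n ≤ p → InWindow s n u → InWindow s n v → u < v → Distinct (+ u) (+ v)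
    inWindow-distinct {s} {n} {u} {v} n≤p (s≤u , u<) (s≤v , v<) u<v p∣v-u =
      <⇒≱ v∸u<p (ℕ.∣⇒≤ {{>-nonZero (m<n⇒0<n∸m u<v)}} p∣v∸u)
      where
      p∣v∸u : p ℕ.∣ v ∸ u
      p∣v∸u = subst (λ z → p ℕ.∣ ∣ z ∣) (trans (m-n≡m⊖n v u) (⊖-≥ (<⇒≤ u<v))) (∣⇒∣ᵤ p∣v-u)
      v∸u<p : v ∸ u < p
      v∸u<p = ≤-trans (s≤s (∸-monoʳ-≤ v s≤u)) (≤-trans (∸-monoˡ-< v< s≤v) (≤-trans (≤-reflexive (m+n∸m≡n s n)) n≤p))

    inWindow-pairwiseDistinct : ∀ {s n} → n ≤ p → ∀ us → AllPairs _<_ us → All (InWindow s n) us →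
                                AllPairs Distinct (map +_ us)
    inWindow-pairwiseDistinct n≤p []       []             []             = []
    inWindow-pairwiseDistinct n≤p (u ∷ us) (u<us ∷ us<) (u∈ ∷ us∈) =
      distinct-from-u us u<us us∈ ∷ inWindow-pairwiseDistinct n≤p us us< us∈
      where
      distinct-from-u : ∀ vs → All (u <_) vs → All (InWindow _ _) vs → All (Distinct (+ u)) (map +_ vs)
      distinct-from-u []       []           []         = []
      distinct-from-u (v ∷ vs) (u<v ∷ u<vs) (v∈ ∷ vs∈) =
        inWindow-distinct n≤p u∈ v∈ u<v ∷ distinct-from-u vs u<vs vs∈

    module _ (R : Poly) (R≢0 : Any (λ a → ¬ (+ p ∣ a)) R)
             (h : ℕ → Bool) (h⇒root : ∀ u → h u ≡ true → Root R (+ u)) where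

      roots-in-window : ∀ s n → n ≤ p → ∑ (λ i → 𝟙 (h (s + i))) n ≤ length R ∸ 1
      roots-in-window s n n≤p with length R ≤? ∑ (λ i → 𝟙 (h (s + i))) n
      ... | no  |R|≰ = suc[m]≤n⇒m≤pred[n] (≰⇒> |R|≰)
      ... | yes |R|≤ = ⊥-elim (Any¬⇒¬All R≢0 (lagrange R (map +_ us) |R|≤|us| distinct roots))
        where
        us = select h s n
        |R|≤|us| : length R ≤ length (map +_ us)
        |R|≤|us| = ≤-trans |R|≤ (≤-reflexive (sym (trans (length-map +_ us) (length-select h s n))))
        distinct = inWindow-pairwiseDistinct n≤p us (select-increasing h s n) (select-inWindow h s n)
        roots = map⁺ (All.map (λ {u} → h⇒root u) (select-sound h s n))

      roots-in-range : ∀ k s n → n ≤ k * p → ∑ (λ i → 𝟙 (h (s + i))) n ≤ k * (length R ∸ 1)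
      roots-in-range zero    s zero    _ = z≤n
      roots-in-range (suc k) s n n≤ with n ≤? p
      ... | yes n≤p = ≤-trans (roots-in-window s n n≤p) (m≤m+n _ _)
      ... | no  n≰p = begin
        ∑ f n                                               ≡⟨ ∑-split-≤ f p≤n ⟩
        ∑ f p + ∑ (λ i → f (p + i)) (n ∸ p)                 ≡⟨ cong (λ x → ∑ f p + x) (∑-cong (n ∸ p) (λ i _ → cong (𝟙 ∘ h) (sym (+-assoc s p i)))) ⟩
        ∑ f p + ∑ (λ i → 𝟙 (h (s + p + i))) (n ∸ p)         ≤⟨ +-mono-≤ (roots-in-window s p ≤-refl) (roots-in-range k (s + p) (n ∸ p) n∸p≤) ⟩
        (length R ∸ 1) + k * (length R ∸ 1)                 ∎
        where
        open ≤-Reasoning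
        f = λ i → 𝟙 (h (s + i))
        p≤n = <⇒≤ (≰⇒> n≰p)
        n∸p≤ : n ∸ p ≤ k * p
        n∸p≤ = ≤-trans (∸-monoˡ-≤ p n≤) (≤-reflexive (m+n∸m≡n p (k * p)))

module PeriodicCounting where

  open import Data.Nat using (zero; suc; _+_; _*_; _/_; _%_; NonZero)
  open import Data.Nat.Properties
  open import Data.Nat.DivMod using (m≡m%n+[m/n]*n; m%n<n; m/n*n≤m)
  open import Data.Nat.Solver using (module +-*-Solver)
  open +-*-Solver using (solve; _:=_; _:+_; _:*_; con)
  open import Data.Bool using (Bool)
  open import Function using (_∘_)
  open import Relation.Binary.PropositionalEquality
    using (_≡_; refl; sym; trans; cong; module ≡-Reasoning)
  open Sums

  count : (ℕ → Bool) → ℕ → ℕ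
  count f = ∑ (𝟙 ∘ f)

  module Periodic (f : ℕ → Bool) (L : ℕ) (periodic : ∀ i → f (i + L) ≡ f i) where

    C : ℕ → ℕ
    C = count f

    s : ℕ
    s = C L

    C-+period : ∀ m → C (L + m) ≡ s + C m
    C-+period m = trans (∑-split _ L m) (cong (s +_) (∑-cong m (λ i _ → cong 𝟙 (trans (cong f (+-comm L i)) (periodic i)))))

    C-+periods : ∀ k r → C (k * L + r) ≡ k * s + C r
    C-+periods zero    r = refl
    C-+periods (suc k) r = begin
      C (L + k * L + r)     ≡⟨ cong C (+-assoc L (k * L) r) ⟩
      C (L + (k * L + r))   ≡⟨ C-+period (k * L + r) ⟩
      s + C (k * L + r)     ≡⟨ cong (s +_) (C-+periods k r) ⟩
      s + (k * s + C r)     ≡⟨ sym (+-assoc s (k * s) (C r)) ⟩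
      s + k * s + C r       ∎
      where open ≡-Reasoning

    module _ .{{_ : NonZero L}} where

      C-divMod : ∀ x → C x ≡ (x / L) * s + C (x % L)
      C-divMod x = trans (cong C (trans (m≡m%n+[m/n]*n x L) (+-comm (x % L) _))) (C-+periods (x / L) (x % L))

      C-mod≤L : ∀ x → C (x % L) ≤ L
      C-mod≤L x = ≤-trans (∑𝟙≤ f (x % L)) (<⇒≤ (m%n<n x L))

      L*C≤ : ∀ x → L * C x ≤ x * s + L * L
      L*C≤ x = begin
        L * C x                  ≡⟨ cong (L *_) (C-divMod x) ⟩
        L * (k * s + C r)        ≡⟨ solve 4 (λ L k s c → L :* (k :* s :+ c) := (k :* L) :* s :+ L :* c) refl L k s (C r) ⟩
        (k * L) * s + L * C r    ≤⟨ +-mono-≤ (*-monoˡ-≤ s (m/n*n≤m x L)) (*-monoʳ-≤ L (C-mod≤L x)) ⟩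
        x * s + L * L            ∎
        where
        open ≤-Reasoning
        k = x / L
        r = x % L

      ≤L*C : ∀ x → x * s ≤ L * C x + L * L
      ≤L*C x = begin
        x * s                    ≡⟨ cong (_* s) (m≡m%n+[m/n]*n x L) ⟩
        (r + k * L) * s          ≡⟨ solve 4 (λ r k L s → (r :+ k :* L) :* s := L :* (k :* s) :+ r :* s) refl r k L s ⟩
        L * (k * s) + r * s      ≤⟨ +-mono-≤ (*-monoʳ-≤ L (m≤m+n (k * s) (C r))) (*-mono-≤ (<⇒≤ (m%n<n x L)) (∑𝟙≤ f L)) ⟩
        L * (k * s + C r) + L * L ≡⟨ cong (λ z → L * z + L * L) (sym (C-divMod x)) ⟩
        L * C x + L * L          ∎
        where
        open ≤-Reasoning
        k = x / L
        r = x % L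

      C-rescale-upper : ∀ n d q X → d * X ≤ n * q → n ≤ d → d * C X ≤ n * C q + 2 * d * L
      C-rescale-upper n d q X dX≤nq n≤d = *-cancelˡ-≤ L (begin
        L * (d * C X)                          ≡⟨ solve 3 (λ L d c → L :* (d :* c) := d :* (L :* c)) refl L d (C X) ⟩
        d * (L * C X)                          ≤⟨ *-monoʳ-≤ d (L*C≤ X) ⟩
        d * (X * s + L * L)                    ≡⟨ solve 4 (λ d X s l → d :* (X :* s :+ l) := (d :* X) :* s :+ d :* l) refl d X s (L * L) ⟩
        (d * X) * s + d * (L * L)              ≤⟨ +-monoˡ-≤ _ (*-monoˡ-≤ s dX≤nq) ⟩
        (n * q) * s + d * (L * L)              ≡⟨ solve 4 (λ n q s l → (n :* q) :* s :+ l := n :* (q :* s) :+ l) refl n q s (d * (L * L)) ⟩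
        n * (q * s) + d * (L * L)              ≤⟨ +-monoˡ-≤ _ (*-monoʳ-≤ n (≤L*C q)) ⟩
        n * (L * C q + L * L) + d * (L * L)    ≡⟨ cong (_+ d * (L * L)) (*-distribˡ-+ n (L * C q) (L * L)) ⟩
        n * (L * C q) + n * (L * L) + d * (L * L)
          ≤⟨ +-monoˡ-≤ _ (+-monoʳ-≤ (n * (L * C q)) (*-monoˡ-≤ (L * L) n≤d)) ⟩
        n * (L * C q) + d * (L * L) + d * (L * L)
          ≡⟨ solve 4 (λ L c n d → n :* (L :* c) :+ d :* (L :* L) :+ d :* (L :* L) := L :* (n :* c :+ con 2 :* d :* L)) refl L (C q) n d ⟩
        L * (n * C q + 2 * d * L)              ∎)
        where open ≤-Reasoning

      C-rescale-lower : ∀ n d q X → n * q ≤ d * X + d → n ≤ d → n * C q ≤ d * C X + 3 * d * L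
      C-rescale-lower n d q X nq≤dX+d n≤d = *-cancelˡ-≤ L (begin
        L * (n * C q)                          ≡⟨ solve 3 (λ L n c → L :* (n :* c) := n :* (L :* c)) refl L n (C q) ⟩
        n * (L * C q)                          ≤⟨ *-monoʳ-≤ n (L*C≤ q) ⟩
        n * (q * s + L * L)                    ≡⟨ solve 4 (λ n q s l → n :* (q :* s :+ l) := (n :* q) :* s :+ n :* l) refl n q s (L * L) ⟩
        (n * q) * s + n * (L * L)              ≤⟨ +-mono-≤ (*-monoˡ-≤ s nq≤dX+d) (*-monoˡ-≤ (L * L) n≤d) ⟩
        (d * X + d) * s + d * (L * L)          ≡⟨ solve 5 (λ d X s l m → (d :* X :+ d) :* s :+ m := d :* (X :* s) :+ d :* s :+ m) refl d X s (L * L) (d * (L * L)) ⟩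
        d * (X * s) + d * s + d * (L * L)      ≤⟨ +-monoˡ-≤ _ (+-mono-≤ (*-monoʳ-≤ d (≤L*C X)) (*-monoʳ-≤ d (≤-trans (∑𝟙≤ f L) (m≤m*n L L)))) ⟩
        d * (L * C X + L * L) + d * (L * L) + d * (L * L)
          ≡⟨ solve 3 (λ d L c → d :* (L :* c :+ L :* L) :+ d :* (L :* L) :+ d :* (L :* L) := L :* (d :* c :+ con 3 :* d :* L)) refl d L (C X) ⟩
        L * (d * C X + 3 * d * L)              ∎)
        where open ≤-Reasoning

module Splitting where

  open import Data.Nat using (suc; _+_; _*_; _∸_; _<_; _/_; NonZero)
  open import Data.Nat.Properties
  open import Data.Nat.DivMod using (m/n*n≤m)
  open import Data.Nat.Solver using (module +-*-Solver)
  open +-*-Solver using (solve; _:=_; _:+_; _:*_; con)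
  open import Data.Bool using (Bool; true; false; _∧_; not)
  open import Data.Bool.Properties using (∧-identityʳ; ∧-zeroʳ)
  open import Data.Empty using (⊥-elim)
  open import Relation.Binary.PropositionalEquality
    using (_≡_; refl; sym; trans; cong; cong₂; module ≡-Reasoning)
  open Sums
  open PairCounting using (countPairs)
  open PeriodicCounting
  open Arithmetic

  count-∧-below : ∀ (g t : ℕ → Bool) X q → X ≤ q →
                  (∀ k → t k ≡ true → k < X) → (∀ k → k < X → t k ≡ true) →
                  ∑ (λ k → 𝟙 (g k ∧ t k)) q ≡ count g X
  count-∧-below g t X q X≤q t⇒<X <X⇒t = begin
    ∑ h q                                     ≡⟨ ∑-split-≤ h X≤q ⟩
    ∑ h X + ∑ (λ k → h (X + k)) (q ∸ X)       ≡⟨ cong₂ _+_ (∑-cong X h≡g) (∑-zero _ (q ∸ X) (λ k _ → h≡0 (X + k) (m≤m+n X k))) ⟩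
    count g X + 0                             ≡⟨ +-identityʳ _ ⟩
    count g X                                 ∎
    where
    open ≡-Reasoning
    h = λ k → 𝟙 (g k ∧ t k)
    h≡g : ∀ k → k < X → h k ≡ 𝟙 (g k)
    h≡g k k<X = trans (cong (λ b → 𝟙 (g k ∧ b)) (<X⇒t k k<X)) (cong 𝟙 (∧-identityʳ (g k)))
    h≡0 : ∀ k → X ≤ k → h k ≡ 0
    h≡0 k X≤k with t k in tk
    ... | true  = ⊥-elim (<⇒≱ (t⇒<X k tk) X≤k)
    ... | false = cong 𝟙 (∧-zeroʳ (g k))

  𝟙-partition : ∀ f g → (f ≡ true → g ≡ true) → 𝟙 f + 𝟙 (g ∧ not f) ≡ 𝟙 g
  𝟙-partition true  true  f⇒g = refl
  𝟙-partition true  false f⇒g with f⇒g refl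
  ... | ()
  𝟙-partition false true  f⇒g = refl
  𝟙-partition false false f⇒g = refl

  𝟙-partition-∧ : ∀ f g t → (f ≡ true → g ≡ true) → 𝟙 (f ∧ t) + 𝟙 ((g ∧ not f) ∧ t) ≡ 𝟙 (g ∧ t)
  𝟙-partition-∧ true  true  true  f⇒g = refl
  𝟙-partition-∧ true  true  false f⇒g = refl
  𝟙-partition-∧ true  false t     f⇒g with f⇒g refl
  ... | ()
  𝟙-partition-∧ false true  t     f⇒g = refl
  𝟙-partition-∧ false false t     f⇒g = refl

  module Discrepancy (f g t : ℕ → ℕ → Bool) (f⇒g : ∀ a q → f a q ≡ true → g a q ≡ true)
    (n d : ℕ) .{{_ : NonZero d}} (n≤d : n ≤ d)
    (t⇒ : ∀ a i → t a (suc i) ≡ true → a * d ≤ n * suc i) (⇒t : ∀ a i → a * d ≤ n * suc i → t a (suc i) ≡ true)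
    (L : ℕ) .{{_ : NonZero L}} (g-periodic : ∀ q i → g (suc (i + L)) q ≡ g (suc i) q) where

    bad : ℕ → ℕ → Bool
    bad a q = g a q ∧ not (f a q)

    threshold : ℕ → ℕ
    threshold q = (n * q) / d

    threshold≤ : ∀ q → threshold q ≤ q
    threshold≤ q = *-cancelʳ-≤ _ q d (≤-trans (m/n*n≤m (n * q) d) (≤-trans (*-monoˡ-≤ q n≤d) (≤-reflexive (*-comm d q))))

    module Column (i : ℕ) where

      q : ℕ
      q = suc i

      fq gq tq badq : ℕ → Bool
      fq   k = f (suc k) q
      gq   k = g (suc k) q
      tq   k = t (suc k) q
      badq k = bad (suc k) q

      good≤ bad≤ good bads : ℕ
      good≤ = ∑ (λ k → 𝟙 (fq k ∧ tq k)) q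
      bad≤  = ∑ (λ k → 𝟙 (badq k ∧ tq k)) q
      good  = count fq q
      bads  = count badq q

      open Periodic gq L (g-periodic q) using (C; C-rescale-upper; C-rescale-lower)

      good≤+bad≤ : good≤ + bad≤ ≡ C (threshold q)
      good≤+bad≤ = begin
        good≤ + bad≤                      ≡⟨ sym (∑-+ _ _ q) ⟩
        ∑ (λ k → 𝟙 (fq k ∧ tq k) + 𝟙 (badq k ∧ tq k)) q
                                          ≡⟨ ∑-cong q (λ k _ → 𝟙-partition-∧ (fq k) (gq k) (tq k) (f⇒g (suc k) q)) ⟩
        ∑ (λ k → 𝟙 (gq k ∧ tq k)) q       ≡⟨ count-∧-below gq tq (threshold q) q (threshold≤ q) t⇒<threshold <threshold⇒t ⟩
        C (threshold q)                   ∎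
        where
        open ≡-Reasoning
        t⇒<threshold : ∀ k → tq k ≡ true → k < threshold q
        t⇒<threshold k tk = m*n≤o⇒m≤o/n (suc k) d (n * q) (t⇒ (suc k) i tk)
        <threshold⇒t : ∀ k → k < threshold q → tq k ≡ true
        <threshold⇒t k k< = ⇒t (suc k) i (m≤o/n⇒m*n≤o (suc k) d (n * q) k<)

      good+bads : good + bads ≡ C q
      good+bads = trans (sym (∑-+ _ _ q)) (∑-cong q (λ k _ → 𝟙-partition (fq k) (gq k) (f⇒g (suc k) q)))

      upper : d * good≤ ≤ n * good + d * (bads + 3 * L)
      upper = begin
        d * good≤                              ≤⟨ *-monoʳ-≤ d (≤-trans (m≤m+n good≤ bad≤) (≤-reflexive good≤+bad≤)) ⟩
        d * C (threshold q)                    ≤⟨ C-rescale-upper n d q (threshold q) (n*[m/n]≤m (n * q) d) n≤d ⟩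
        n * C q + 2 * d * L                    ≡⟨ cong (λ c → n * c + 2 * d * L) (sym good+bads) ⟩
        n * (good + bads) + 2 * d * L          ≤⟨ +-monoˡ-≤ _ (≤-reflexive (*-distribˡ-+ n good bads)) ⟩
        n * good + n * bads + 2 * d * L        ≤⟨ +-monoˡ-≤ _ (+-monoʳ-≤ (n * good) (*-monoˡ-≤ bads n≤d)) ⟩
        n * good + d * bads + 2 * d * L        ≡⟨ solve 4 (λ a d b L → a :+ d :* b :+ con 2 :* d :* L := a :+ d :* (b :+ con 2 :* L))
                                                    refl (n * good) d bads L ⟩
        n * good + d * (bads + 2 * L)          ≤⟨ +-monoʳ-≤ (n * good) (*-monoʳ-≤ d (+-monoʳ-≤ bads (*-monoˡ-≤ L (n≤1+n 2)))) ⟩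
        n * good + d * (bads + 3 * L)          ∎
        where open ≤-Reasoning

      lower : n * good ≤ d * good≤ + d * (bads + 3 * L)
      lower = begin
        n * good                               ≤⟨ *-monoʳ-≤ n (≤-trans (m≤m+n good bads) (≤-reflexive good+bads)) ⟩
        n * C q                                ≤⟨ C-rescale-lower n d q (threshold q) (m≤n*[m/n]+n (n * q) d) n≤d ⟩
        d * C (threshold q) + 3 * d * L        ≡⟨ cong (λ c → d * c + 3 * d * L) (sym good≤+bad≤) ⟩
        d * (good≤ + bad≤) + 3 * d * L         ≤⟨ +-monoˡ-≤ _ (*-monoʳ-≤ d (+-monoʳ-≤ good≤ bad≤≤bads)) ⟩
        d * (good≤ + bads) + 3 * d * L         ≡⟨ solve 4 (λ d a b L → d :* (a :+ b) :+ con 3 :* d :* L := d :* a :+ d :* (b :+ con 3 :* L))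
                                                    refl d good≤ bads L ⟩
        d * good≤ + d * (bads + 3 * L)         ∎
        where
        open ≤-Reasoning
        bad≤≤bads : bad≤ ≤ bads
        bad≤≤bads = ∑-mono q (λ k _ → 𝟙-∧-≤ˡ (badq k) (tq k))

    ∑-affine : ∀ (u v : ℕ → ℕ) c e Q → ∑ (λ i → c * u i + d * (v i + e)) Q ≡ c * ∑ u Q + d * (∑ v Q + e * Q)
    ∑-affine u v c e Q = begin
      ∑ (λ i → c * u i + d * (v i + e)) Q              ≡⟨ ∑-+ _ _ Q ⟩
      ∑ (λ i → c * u i) Q + ∑ (λ i → d * (v i + e)) Q  ≡⟨ cong₂ _+_ (∑-* c u Q) (∑-* d (λ i → v i + e) Q) ⟩
      c * ∑ u Q + d * ∑ (λ i → v i + e) Q              ≡⟨ cong (λ x → c * ∑ u Q + d * x) (∑-+ v (λ _ → e) Q) ⟩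
      c * ∑ u Q + d * (∑ v Q + ∑ (λ _ → e) Q)          ≡⟨ cong (λ x → c * ∑ u Q + d * (∑ v Q + x)) (trans (∑-const e Q) (*-comm Q e)) ⟩
      c * ∑ u Q + d * (∑ v Q + e * Q)                  ∎
      where open ≡-Reasoning

    total-upper : ∀ Q → d * countPairs (λ a q → f a q ∧ t a q) Q ≤ n * countPairs f Q + d * (countPairs bad Q + 3 * L * Q)
    total-upper Q = begin
      d * countPairs (λ a q → f a q ∧ t a q) Q                               ≡⟨ sym (∑-* d _ Q) ⟩
      ∑ (λ i → d * Column.good≤ i) Q                                   ≤⟨ ∑-mono Q (λ i _ → Column.upper i) ⟩
      ∑ (λ i → n * Column.good i + d * (Column.bads i + 3 * L)) Q ≡⟨ ∑-affine _ _ n (3 * L) Q ⟩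
      n * countPairs f Q + d * (countPairs bad Q + 3 * L * Q)                ∎
      where open ≤-Reasoning

    total-lower : ∀ Q → n * countPairs f Q ≤ d * countPairs (λ a q → f a q ∧ t a q) Q + d * (countPairs bad Q + 3 * L * Q)
    total-lower Q = begin
      n * countPairs f Q                                                      ≡⟨ sym (∑-* n _ Q) ⟩
      ∑ (λ i → n * Column.good i) Q                                     ≤⟨ ∑-mono Q (λ i _ → Column.lower i) ⟩
      ∑ (λ i → d * Column.good≤ i + d * (Column.bads i + 3 * L)) Q ≡⟨ ∑-affine _ _ d (3 * L) Q ⟩
      d * countPairs (λ a q → f a q ∧ t a q) Q + d * (countPairs bad Q + 3 * L * Q) ∎
      where open ≤-Reasoning

module Estimates where

  open import Data.Nat using (zero; suc; _+_; _*_; _∸_; _<_; _<?_; _≤?_; _/_; z≤n; s≤s; >-nonZero)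
  open import Data.Nat.Properties
  open import Data.Nat.DivMod using (m/n*n≤m; m/n≤m)
  open import Data.Nat.Solver using (module +-*-Solver)
  open +-*-Solver using (solve; _:=_; _:+_; _:*_; con)
  open import Data.Empty using (⊥-elim)
  open import Relation.Nullary using (yes; no)
  open import Relation.Nullary.Decidable using (⌊_⌋)
  open import Relation.Binary.PropositionalEquality
    using (_≡_; refl; sym; trans; cong; cong₂; module ≡-Reasoning)
  open Sums
  open Arithmetic using (⌊⌋≡true)

  tailSum : ℕ → ℕ → ℕ → ℕ
  tailSum z Q T = ∑ (λ m → 𝟙 ⌊ z <? suc m ⌋ * ((Q / suc m) * (T / suc m))) Q

  harmonic : ℕ → ℕ
  harmonic Q = ∑ (λ m → Q / suc m) Q

  module _ (z K : ℕ) (z≥1 : 1 ≤ z) (w : ℕ → ℕ) (w≤ : ∀ m → z < suc m → suc m * m * w m ≤ K) where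

    tail : ℕ → ℕ
    tail R = ∑ (λ m → 𝟙 ⌊ z <? suc m ⌋ * w m) R

    tail-≤z : ∀ R → R ≤ z → tail R ≡ 0
    tail-≤z zero    _   = refl
    tail-≤z (suc R) R<z with z <? suc R
    ... | yes z<R = ⊥-elim (<⇒≱ z<R R<z)
    ... | no  _   = trans (+-identityʳ _) (tail-≤z R (≤-trans (n≤1+n R) R<z))

    -- ∑_{z ≤ m < R} K / ((m + 1) m) telescopes to at most K / z.
    tail-telescope : ∀ D → z * (z + D) * tail (z + D) ≤ K * D
    tail-telescope zero    = ≤-reflexive (trans (cong (z * (z + 0) *_) (tail-≤z (z + 0) (≤-reflexive (+-identityʳ z))))
                                                 (trans (*-zeroʳ (z * (z + 0))) (sym (*-zeroʳ K))))
    tail-telescope (suc D) = *-cancelˡ-≤ R {{>-nonZero (≤-trans z≥1 (m≤m+n z D))}} (begin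
      R * (z * (z + suc D) * tail (z + suc D))
        ≡⟨ cong (λ x → R * (z * x * tail x)) (+-suc z D) ⟩
      R * (z * suc R * (tail R + 𝟙 ⌊ z <? suc R ⌋ * w R))
        ≡⟨ cong (λ b → R * (z * suc R * (tail R + 𝟙 b * w R))) (⌊⌋≡true (z <? suc R) (s≤s (m≤m+n z D))) ⟩
      R * (z * suc R * (tail R + 1 * w R))
        ≡⟨ solve 4 (λ R z s w → R :* (z :* (con 1 :+ R) :* (s :+ con 1 :* w))
                               := (con 1 :+ R) :* (z :* R :* s) :+ z :* ((con 1 :+ R) :* R :* w)) refl R z (tail R) (w R) ⟩
      suc R * (z * R * tail R) + z * (suc R * R * w R)
        ≤⟨ +-mono-≤ (*-monoʳ-≤ (suc R) (tail-telescope D)) (*-monoʳ-≤ z (w≤ R (s≤s (m≤m+n z D)))) ⟩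
      suc R * (K * D) + z * K
        ≡⟨ solve 3 (λ z D K → (con 1 :+ (z :+ D)) :* (K :* D) :+ z :* K := (z :+ D) :* (K :* (con 1 :+ D))) refl z D K ⟩
      R * (K * suc D) ∎)
      where
      open ≤-Reasoning
      R = z + D

    z*tail≤K : ∀ R → z * tail R ≤ K
    z*tail≤K R with R ≤? z
    ... | yes R≤z = ≤-trans (≤-reflexive (trans (cong (z *_) (tail-≤z R R≤z)) (*-zeroʳ z))) z≤n
    ... | no  R≰z = *-cancelˡ-≤ R {{>-nonZero (≤-trans z≥1 z≤R)}} (begin
      R * (z * tail R)               ≡⟨ cong (λ x → x * (z * tail x)) (sym z+D≡R) ⟩
      (z + D) * (z * tail (z + D))   ≡⟨ solve 3 (λ a z s → a :* (z :* s) := z :* a :* s) refl (z + D) z (tail (z + D)) ⟩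
      z * (z + D) * tail (z + D)     ≤⟨ tail-telescope D ⟩
      K * D                          ≤⟨ *-monoʳ-≤ K (m≤n+m D z) ⟩
      K * (z + D)                    ≡⟨ cong (K *_) z+D≡R ⟩
      K * R                          ≡⟨ *-comm K R ⟩
      R * K                          ∎)
      where
      open ≤-Reasoning
      z≤R = <⇒≤ (≰⇒> R≰z)
      D = R ∸ z
      z+D≡R : z + D ≡ R
      z+D≡R = m+[n∸m]≡n z≤R

  z*tailSum≤ : ∀ z Q T → 1 ≤ z → z * tailSum z Q T ≤ Q * T
  z*tailSum≤ z Q T z≥1 = z*tail≤K z (Q * T) z≥1 (λ m → (Q / suc m) * (T / suc m)) (λ m _ → two-quotients m) Q
    where
    two-quotients : ∀ m → suc m * m * ((Q / suc m) * (T / suc m)) ≤ Q * T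
    two-quotients m = begin
      p * m * ((Q / p) * (T / p))    ≤⟨ *-monoˡ-≤ _ (*-monoʳ-≤ p (n≤1+n m)) ⟩
      p * p * ((Q / p) * (T / p))    ≡⟨ solve 3 (λ p a b → p :* p :* (a :* b) := (a :* p) :* (b :* p)) refl p (Q / p) (T / p) ⟩
      ((Q / p) * p) * ((T / p) * p)  ≤⟨ *-mono-≤ (m/n*n≤m Q p) (m/n*n≤m T p) ⟩
      Q * T                          ∎
      where
      open ≤-Reasoning
      p = suc m

  count<≤ : ∀ K R → ∑ (λ m → 𝟙 ⌊ m <? K ⌋) R ≤ K
  count<≤ K R with R ≤? K
  ... | yes R≤K = ≤-trans (∑𝟙≤ (λ m → ⌊ m <? K ⌋) R) R≤K
  ... | no  R≰K = begin
    ∑ f R                                   ≡⟨ ∑-split-≤ f K≤R ⟩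
    ∑ f K + ∑ (λ j → f (K + j)) (R ∸ K)     ≡⟨ cong (∑ f K +_) (∑-zero _ (R ∸ K) (λ j _ → f[K+j]≡0 j)) ⟩
    ∑ f K + 0                               ≡⟨ +-identityʳ _ ⟩
    ∑ f K                                   ≤⟨ ∑𝟙≤ (λ m → ⌊ m <? K ⌋) K ⟩
    K                                       ∎
    where
    open ≤-Reasoning
    f = λ m → 𝟙 ⌊ m <? K ⌋
    K≤R = <⇒≤ (≰⇒> R≰K)
    f[K+j]≡0 : ∀ j → f (K + j) ≡ 0
    f[K+j]≡0 j with K + j <? K
    ... | yes K+j<K = ⊥-elim (<⇒≱ K+j<K (m≤m+n K j))
    ... | no  _     = refl

  -- Split ∑_{m<Q} Q/(m+1) at m = K: the first K terms are at most Q, the others at most Q/K.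
  K*harmonic≤ : ∀ K Q → K * harmonic Q ≤ K * K * Q + Q * Q
  K*harmonic≤ K Q = begin
    K * harmonic Q                                         ≡⟨ sym (∑-* K _ Q) ⟩
    ∑ (λ m → K * (Q / suc m)) Q                            ≤⟨ ∑-mono Q (λ m _ → termwise m) ⟩
    ∑ (λ m → (K * Q) * 𝟙 ⌊ m <? K ⌋ + Q) Q                 ≡⟨ ∑-+ _ _ Q ⟩
    ∑ (λ m → (K * Q) * 𝟙 ⌊ m <? K ⌋) Q + ∑ (λ _ → Q) Q     ≡⟨ cong₂ _+_ (∑-* (K * Q) _ Q) (∑-const Q Q) ⟩
    (K * Q) * ∑ (λ m → 𝟙 ⌊ m <? K ⌋) Q + Q * Q             ≤⟨ +-monoˡ-≤ (Q * Q) (*-monoʳ-≤ (K * Q) (count<≤ K Q)) ⟩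
    (K * Q) * K + Q * Q                                    ≡⟨ cong (_+ Q * Q) (solve 2 (λ k q → (k :* q) :* k := k :* k :* q) refl K Q) ⟩
    K * K * Q + Q * Q                                      ∎
    where
    open ≤-Reasoning
    termwise : ∀ m → K * (Q / suc m) ≤ (K * Q) * 𝟙 ⌊ m <? K ⌋ + Q
    termwise m with m <? K
    ... | yes _   = ≤-trans (*-monoʳ-≤ K (m/n≤m Q (suc m))) (≤-trans (≤-reflexive (sym (*-identityʳ (K * Q)))) (m≤m+n _ Q))
    ... | no  m≮K = ≤-trans (*-monoˡ-≤ (Q / suc m) (≤-trans (≮⇒≥ m≮K) (n≤1+n m)))
                            (≤-trans (≤-reflexive (*-comm (suc m) (Q / suc m))) (≤-trans (m/n*n≤m Q (suc m)) (m≤n+m Q _)))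

  progression-sum : ∀ M T → M * T * T ≤ 2 * ∑ (λ t → suc (M * t)) T + M * T
  progression-sum M zero    = ≤-trans (≤-reflexive (*-zeroʳ (M * 0))) z≤n
  progression-sum M (suc T) = begin
    M * suc T * suc T                              ≡⟨ solve 2 (λ M T → M :* (con 1 :+ T) :* (con 1 :+ T)
                                                                  := M :* T :* T :+ (con 2 :* (M :* T) :+ M)) refl M T ⟩
    M * T * T + (2 * (M * T) + M)                  ≤⟨ +-monoˡ-≤ _ (progression-sum M T) ⟩
    2 * S + M * T + (2 * (M * T) + M)              ≤⟨ m≤m+n _ 2 ⟩
    2 * S + M * T + (2 * (M * T) + M) + 2          ≡⟨ solve 3 (λ S M T → con 2 :* S :+ M :* T :+ (con 2 :* (M :* T) :+ M) :+ con 2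
                                                                  := con 2 :* (S :+ (con 1 :+ M :* T)) :+ M :* (con 1 :+ T)) refl S M T ⟩
    2 * (S + suc (M * T)) + M * suc T              ∎
    where
    open ≤-Reasoning
    S = ∑ (λ t → suc (M * t)) T

module Sieve (P : Poly) where

  open import Data.Nat using (zero; suc; _+_; _*_; _∸_; _<_; _<?_; _≟_; z≤n; s≤s; _/_; NonZero; >-nonZero)
  open import Data.Nat.Properties
  open import Data.Nat.Divisibility as ℕ using (_∣_; _∣?_; ∣-antisym; ∣-trans; ∣1⇒≡1; ∣m+n∣m⇒∣n; ∣⇒≤)
  open import Data.Nat.DivMod using (m/n*n≡m; /-monoˡ-≤)
  open import Data.Nat.GCD using (gcd; gcd[m,n]∣m; gcd[m,n]∣n; gcd-greatest; gcd[m,n]≡0⇒n≡0; gcd-zeroˡ)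
  open import Data.Nat.Primality using (Prime; prime?; ¬prime[0]; ¬prime[1]; prime⇒nonZero)
  open import Data.Nat.Solver using (module +-*-Solver)
  open +-*-Solver using (solve; _:=_; _:+_; _:*_; con)
  open import Data.Integer as ℤ using (+_; 1ℤ)
  import Data.Integer.Properties as ℤ
  import Data.Integer.Divisibility.Signed as ℤ
  open import Data.List using ([]; _∷_; length)
  open import Data.List.Relation.Unary.Any using (Any; here)
  open import Data.Bool using (Bool; true; false; _∧_; not)
  open import Data.Product using (_×_; _,_; proj₁; proj₂)
  open import Data.Empty using (⊥-elim)
  open import Function using (_∘_)
  open import Relation.Nullary using (¬_; Dec; yes; no)
  open import Relation.Nullary.Decidable using (⌊_⌋)
  open import Relation.Binary.PropositionalEquality
    using (_≡_; _≢_; refl; sym; trans; cong; cong₂; subst; module ≡-Reasoning)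
  open Sums
  open PairCounting using (countPairs)
  open Polynomial using (eval-periodic; ∣m-n⇒∣n-m; ∣m-n∣n⇒∣m)
  open RootCounting using (roots-in-range)
  open Arithmetic
  open Estimates using (tailSum; harmonic)

  ∣P∣ : ℕ → ℕ
  ∣P∣ a = ℤ.∣ eval P (+ a) ∣

  deg : ℕ
  deg = length P ∸ 1

  gcdCoprimeTo : ℕ → ℕ → ℕ → Bool
  gcdCoprimeTo L a q = ⌊ gcd (gcd (∣P∣ a) q) L ≟ 1 ⌋

  bad : ℕ → ℕ → ℕ → Bool
  bad L a q = gcdCoprimeTo L a q ∧ not (coprimeP P a q)

  coprimeP⇒gcdCoprimeTo : ∀ L a q → coprimeP P a q ≡ true → gcdCoprimeTo L a q ≡ true
  coprimeP⇒gcdCoprimeTo L a q coprime =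
    ⌊⌋≡true (gcd (gcd (∣P∣ a) q) L ≟ 1) (trans (cong (λ g → gcd g L) (⌊⌋≡true⇒ (gcd (∣P∣ a) q ≟ 1) coprime)) (gcd-zeroˡ L))

  gcd-congruent-∣ : ∀ L q u v → + L ℤ.∣ u ℤ.- v → gcd (gcd ℤ.∣ v ∣ q) L ∣ gcd (gcd ℤ.∣ u ∣ q) L
  gcd-congruent-∣ L q u v L∣u-v = gcd-greatest (gcd-greatest g∣u g∣q) g∣L
    where
    g = gcd (gcd ℤ.∣ v ∣ q) L
    g∣L : g ∣ L
    g∣L = gcd[m,n]∣n (gcd ℤ.∣ v ∣ q) L
    g∣q : g ∣ q
    g∣q = ∣-trans (gcd[m,n]∣m _ L) (gcd[m,n]∣n ℤ.∣ v ∣ q)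
    g∣v : + g ℤ.∣ v
    g∣v = ℤ.∣ᵤ⇒∣ (∣-trans (gcd[m,n]∣m _ L) (gcd[m,n]∣m ℤ.∣ v ∣ q))
    g∣u : g ∣ ℤ.∣ u ∣
    g∣u = ℤ.∣⇒∣ᵤ (∣m-n∣n⇒∣m u v (ℤ.∣-trans (ℤ.∣ᵤ⇒∣ g∣L) L∣u-v) g∣v)

  gcdCoprimeTo-periodic : ∀ L q i → gcdCoprimeTo L (suc (i + L)) q ≡ gcdCoprimeTo L (suc i) q
  gcdCoprimeTo-periodic L q i = cong (λ g → ⌊ g ≟ 1 ⌋) (∣-antisym (gcd-congruent-∣ L q v u L∣v-u) (gcd-congruent-∣ L q u v L∣u-v))
    where
    u = eval P (+ suc (i + L))
    v = eval P (+ suc i)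
    L∣u-v : + L ℤ.∣ u ℤ.- v
    L∣u-v = eval-periodic P (+ suc i) (+ L)
    L∣v-u : + L ℤ.∣ v ℤ.- u
    L∣v-u = ∣m-n⇒∣n-m u v L∣u-v

  obstructs : ℕ → ℕ → ℕ → ℕ → Bool
  obstructs L p a q = ⌊ prime? p ⌋ ∧ not ⌊ p ∣? L ⌋ ∧ ⌊ p ∣? q ⌋ ∧ ⌊ p ∣? ∣P∣ a ⌋

  bad⇒obstruction : ∀ L a q → 1 ≤ q → bad L a q ≡ true →
                    ∃[ p ] (Prime p × ¬ (p ∣ L) × (p ∣ q) × (p ∣ ∣P∣ a))
  bad⇒obstruction L a q q≥1 is-bad with gcdCoprimeTo L a q in mod | coprimeP P a q in coprime
  bad⇒obstruction L a q q≥1 () | false | _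
  bad⇒obstruction L a q q≥1 () | true  | true
  ... | true | false with ∃primeFactor G 2≤G
    where
    G = gcd (∣P∣ a) q
    G≢1 : G ≢ 1
    G≢1 = ⌊⌋≡false⇒¬ (G ≟ 1) coprime
    2≤G : 2 ≤ G
    2≤G with G | G≢1 | gcd[m,n]≡0⇒n≡0 (∣P∣ a) {q}
    ... | zero        | _   | G≡0⇒q≡0 = ⊥-elim (<⇒≢ q≥1 (sym (G≡0⇒q≡0 refl)))
    ... | suc zero    | G≢1 | _       = ⊥-elim (G≢1 refl)
    ... | suc (suc _) | _   | _       = s≤s (s≤s z≤n)
  ... | p , p-prime , p∣G = p , p-prime , p∤L , ∣-trans p∣G (gcd[m,n]∣n (∣P∣ a) q) , ∣-trans p∣G (gcd[m,n]∣m (∣P∣ a) q)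
    where
    p∤L : ¬ (p ∣ L)
    p∤L p∣L = ¬prime[1] (subst Prime (∣1⇒≡1 (subst (p ∣_) (⌊⌋≡true⇒ (_ ≟ 1) mod) (gcd-greatest p∣G p∣L))) p-prime)

  obstructs-true : ∀ L p a q → Prime p → ¬ (p ∣ L) → p ∣ q → p ∣ ∣P∣ a → obstructs L p a q ≡ true
  obstructs-true L p a q p-prime p∤L p∣q p∣Pa
    rewrite ⌊⌋≡true (prime? p) p-prime | ⌊⌋≡true (p ∣? q) p∣q | ⌊⌋≡true (p ∣? ∣P∣ a) p∣Pa with p ∣? L
  ... | yes p∣L = ⊥-elim (p∤L p∣L)
  ... | no  _   = refl

  obstructs-false : ∀ L p a q → ¬ (Prime p × ¬ (p ∣ L)) → obstructs L p a q ≡ false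
  obstructs-false L p a q not-admissible with prime? p | p ∣? L
  ... | no  _       | _       = refl
  ... | yes _       | yes _   = refl
  ... | yes p-prime | no  p∤L = ⊥-elim (not-admissible (p-prime , p∤L))

  𝟙bad≤∑obstructs : ∀ L a q Q → 1 ≤ q → q ≤ Q → 𝟙 (bad L a q) ≤ ∑ (λ m → 𝟙 (obstructs L (suc m) a q)) Q
  𝟙bad≤∑obstructs L a q Q q≥1 q≤Q with bad L a q in is-bad
  ... | false = z≤n
  ... | true with bad⇒obstruction L a q q≥1 is-bad
  ...   | zero  , 0-prime , _ = ⊥-elim (¬prime[0] 0-prime)
  ...   | suc m , p-prime , p∤L , p∣q , p∣Pa =
    ≤-trans (≤-reflexive (cong 𝟙 (sym (obstructs-true L (suc m) a q p-prime p∤L p∣q p∣Pa))))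
            (term≤∑ (λ m → 𝟙 (obstructs L (suc m) a q)) (≤-trans (∣⇒≤ {{>-nonZero q≥1}} p∣q) q≤Q))

  Admissible : ℕ → ℕ → Set
  Admissible L z = ∀ p → Prime p → ¬ (p ∣ L) → z < p × Any (λ c → ¬ (+ p ℤ.∣ c)) P

  module _ {p : ℕ} (p-prime : Prime p) (P≢0 : Any (λ c → ¬ (+ p ℤ.∣ c)) P) where

    instance
      p≢0 : NonZero p
      p≢0 = prime⇒nonZero p-prime

    obstructs-∤ : ∀ L a q → ¬ (p ∣ q) → obstructs L p a q ≡ false
    obstructs-∤ L a q p∤q with prime? p | p ∣? L | p ∣? q
    ... | no  _ | _     | _       = refl
    ... | yes _ | yes _ | _       = refl
    ... | yes _ | no  _ | no  _   = refl
    ... | yes _ | no  _ | yes p∣q = ⊥-elim (p∤q p∣q)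

    obstructs-column≤ : ∀ L q → ∑ (λ k → 𝟙 (obstructs L p (suc k) q)) q ≤ 𝟙 ⌊ p ∣? q ⌋ * ((q / p) * deg)
    obstructs-column≤ L q = by-cases (p ∣? q)
      where
      open ≤-Reasoning
      X = (q / p) * deg
      root? : ℕ → Bool
      root? a = ⌊ p ∣? ∣P∣ a ⌋
      root?⇒root : ∀ a → root? a ≡ true → + p ℤ.∣ eval P (+ a)
      root?⇒root a is-root = ℤ.∣ᵤ⇒∣ (⌊⌋≡true⇒ (p ∣? ∣P∣ a) is-root)
      ≤-root : ∀ a → 𝟙 (obstructs L p a q) ≤ 𝟙 (root? a)
      ≤-root a = ≤-trans (𝟙-∧-≤ʳ ⌊ prime? p ⌋ _) (≤-trans (𝟙-∧-≤ʳ (not ⌊ p ∣? L ⌋) _) (𝟙-∧-≤ʳ ⌊ p ∣? q ⌋ (root? a)))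
      by-cases : Dec (p ∣ q) → ∑ (λ k → 𝟙 (obstructs L p (suc k) q)) q ≤ 𝟙 ⌊ p ∣? q ⌋ * X
      by-cases (no p∤q) = ≤-trans (≤-reflexive (∑-zero _ q (λ k _ → cong 𝟙 (obstructs-∤ L (suc k) q p∤q)))) z≤n
      by-cases (yes p∣q) = begin
        ∑ (λ k → 𝟙 (obstructs L p (suc k) q)) q    ≤⟨ ∑-mono q (λ k _ → ≤-root (suc k)) ⟩
        ∑ (λ k → 𝟙 (root? (suc k))) q              ≤⟨ roots-in-range p-prime P P≢0 root? root?⇒root (q / p) 1 q q≤ ⟩
        X                                          ≡⟨ sym (+-identityʳ X) ⟩
        1 * X                                      ≡⟨ cong (λ b → 𝟙 b * X) (sym (⌊⌋≡true (p ∣? q) p∣q)) ⟩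
        𝟙 ⌊ p ∣? q ⌋ * X                           ∎
        where
        q≤ : q ≤ (q / p) * p
        q≤ = ≤-reflexive (sym (m/n*n≡m p∣q))
    multiples-in-progression≤ : ∀ M T → ∑ (λ t → 𝟙 ⌊ p ∣? suc (M * t) ⌋) T ≤ T / p + 1
    multiples-in-progression≤ M T =
      ≤-trans (roots-in-range p-prime R (here p∤1) multiple? multiple?⇒root (T / p + 1) 0 T T≤) (≤-reflexive (*-identityʳ _))
      where
      R : Poly
      R = 1ℤ ∷ + M ∷ []
      p∤1 : ¬ (+ p ℤ.∣ 1ℤ)
      p∤1 p∣1 = ¬prime[1] (subst Prime (∣1⇒≡1 (ℤ.∣⇒∣ᵤ p∣1)) p-prime)
      multiple? : ℕ → Bool
      multiple? t = ⌊ p ∣? suc (M * t) ⌋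
      eval-R : ∀ t → eval R (+ t) ≡ + suc (M * t)
      eval-R t = begin
        1ℤ ℤ.+ + t ℤ.* (+ M ℤ.+ + t ℤ.* 0ℤ)  ≡⟨ cong (λ x → 1ℤ ℤ.+ + t ℤ.* x) (trans (cong (λ x → + M ℤ.+ x) (ℤ.*-zeroʳ (+ t))) (ℤ.+-identityʳ (+ M))) ⟩
        1ℤ ℤ.+ + t ℤ.* + M                   ≡⟨ cong (λ x → 1ℤ ℤ.+ x) (sym (ℤ.pos-* t M)) ⟩
        + suc (t * M)                         ≡⟨ cong (λ x → + suc x) (*-comm t M) ⟩
        + suc (M * t)                         ∎
        where open ≡-Reasoning
      multiple?⇒root : ∀ t → multiple? t ≡ true → + p ℤ.∣ eval R (+ t)
      multiple?⇒root t is-multiple = subst (+ p ℤ.∣_) (sym (eval-R t)) (ℤ.∣ᵤ⇒∣ (⌊⌋≡true⇒ (p ∣? suc (M * t)) is-multiple))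
      T≤ : T ≤ (T / p + 1) * p
      T≤ = ≤-trans (m≤n*[m/n]+n T p) (≤-reflexive (solve 2 (λ p x → p :* x :+ p := (x :+ con 1) :* p) refl p (T / p)))

  obstructs-along : ∀ L z → Admissible L z → ∀ M Q T m → (∀ t → t < T → suc (M * t) ≤ Q) →
    ∑ (λ t → ∑ (λ k → 𝟙 (obstructs L (suc m) (suc k) (suc (M * t)))) (suc (M * t))) T
      ≤ 𝟙 ⌊ z <? suc m ⌋ * (deg * ((Q / suc m) * (T / suc m))) + deg * (Q / suc m)
  obstructs-along L z admissible M Q T m q≤Q = by-cases (prime? p) (p ∣? L)
    where
    p = suc m
    q : ℕ → ℕ
    q t = suc (M * t)
    Goal : Set
    Goal = ∑ (λ t → ∑ (λ k → 𝟙 (obstructs L p (suc k) (q t))) (q t)) T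
             ≤ 𝟙 ⌊ z <? p ⌋ * (deg * ((Q / p) * (T / p))) + deg * (Q / p)
    vanish : ¬ (Prime p × ¬ (p ∣ L)) → Goal
    vanish not-admissible = ≤-trans (≤-reflexive (∑-zero _ T (λ t _ → ∑-zero _ (q t)
      (λ k _ → cong 𝟙 (obstructs-false L p (suc k) (q t) not-admissible))))) z≤n
    by-cases : Dec (Prime p) → Dec (p ∣ L) → Goal
    by-cases (no ¬prime)   _         = vanish (λ (p-prime , _) → ¬prime p-prime)
    by-cases (yes _)       (yes p∣L) = vanish (λ (_ , p∤L) → p∤L p∣L)
    by-cases (yes p-prime) (no p∤L)  = begin
      ∑ (λ t → ∑ (λ k → 𝟙 (obstructs L p (suc k) (q t))) (q t)) T
        ≤⟨ ∑-mono T (λ t _ → obstructs-column≤ p-prime P≢0 L (q t)) ⟩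
      ∑ (λ t → 𝟙 (multiple? t) * ((q t / p) * deg)) T
        ≤⟨ ∑-mono T (λ t t<T → *-monoʳ-≤ (𝟙 (multiple? t)) (*-monoˡ-≤ deg (/-monoˡ-≤ p (q≤Q t t<T)))) ⟩
      ∑ (λ t → 𝟙 (multiple? t) * ((Q / p) * deg)) T
        ≡⟨ ∑-cong T (λ t _ → *-comm (𝟙 (multiple? t)) _) ⟩
      ∑ (λ t → ((Q / p) * deg) * 𝟙 (multiple? t)) T
        ≡⟨ ∑-* ((Q / p) * deg) (λ t → 𝟙 (multiple? t)) T ⟩
      ((Q / p) * deg) * ∑ (λ t → 𝟙 (multiple? t)) T
        ≤⟨ *-monoʳ-≤ ((Q / p) * deg) (multiples-in-progression≤ p-prime P≢0 M T) ⟩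
      ((Q / p) * deg) * (T / p + 1)
        ≡⟨ solve 3 (λ a b v → (a :* v) :* (b :+ con 1) := con 1 :* (v :* (a :* b)) :+ v :* a) refl (Q / p) (T / p) deg ⟩
      1 * (deg * ((Q / p) * (T / p))) + deg * (Q / p)
        ≡⟨ cong (λ b → 𝟙 b * (deg * ((Q / p) * (T / p))) + deg * (Q / p)) (sym (⌊⌋≡true (z <? p) z<p)) ⟩
      𝟙 ⌊ z <? p ⌋ * (deg * ((Q / p) * (T / p))) + deg * (Q / p) ∎
      where
      open ≤-Reasoning
      z<p = proj₁ (admissible p p-prime p∤L)
      P≢0 = proj₂ (admissible p p-prime p∤L)
      multiple? : ℕ → Bool
      multiple? t = ⌊ p ∣? q t ⌋

  bad-along : ∀ L z → Admissible L z → ∀ M Q T → (∀ t → t < T → suc (M * t) ≤ Q) →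
    ∑ (λ t → ∑ (λ k → 𝟙 (bad L (suc k) (suc (M * t)))) (suc (M * t))) T ≤ deg * tailSum z Q T + deg * harmonic Q
  bad-along L z admissible M Q T q≤Q = begin
    ∑ (λ t → ∑ (λ k → 𝟙 (bad L (suc k) (q t))) (q t)) T
      ≤⟨ ∑-mono T (λ t t<T → ∑-mono (q t) (λ k _ → 𝟙bad≤∑obstructs L (suc k) (q t) Q (s≤s z≤n) (q≤Q t t<T))) ⟩
    ∑ (λ t → ∑ (λ k → ∑ (λ m → 𝟙 (obstructs L (suc m) (suc k) (q t))) Q) (q t)) T
      ≡⟨ ∑-swap₃ (λ m t k → 𝟙 (obstructs L (suc m) (suc k) (q t))) q T Q ⟩
    ∑ (λ m → ∑ (λ t → ∑ (λ k → 𝟙 (obstructs L (suc m) (suc k) (q t))) (q t)) T) Q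
      ≤⟨ ∑-mono Q (λ m _ → obstructs-along L z admissible M Q T m q≤Q) ⟩
    ∑ (λ m → a m * (deg * b m) + deg * (Q / suc m)) Q
      ≡⟨ ∑-+ _ _ Q ⟩
    ∑ (λ m → a m * (deg * b m)) Q + ∑ (λ m → deg * (Q / suc m)) Q
      ≡⟨ cong₂ _+_ (trans (∑-cong Q (λ m _ → solve 3 (λ a v b → a :* (v :* b) := v :* (a :* b)) refl (a m) deg (b m)))
                          (∑-* deg (λ m → a m * b m) Q))
                   (∑-* deg (λ m → Q / suc m) Q) ⟩
    deg * tailSum z Q T + deg * harmonic Q ∎
    where
    open ≤-Reasoning
    q : ℕ → ℕ
    q t = suc (M * t)
    a b : ℕ → ℕ
    a m = 𝟙 ⌊ z <? suc m ⌋
    b m = (Q / suc m) * (T / suc m)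

  bad-total≤ : ∀ L z → Admissible L z → ∀ Q → countPairs (bad L) Q ≤ deg * tailSum z Q Q + deg * harmonic Q
  bad-total≤ L z admissible Q =
    ≤-trans (≤-reflexive (∑-cong Q (λ t _ → cong (λ q → ∑ (λ k → 𝟙 (bad L (suc k) q)) q) (cong suc (sym (*-identityˡ t))))))
            (bad-along L z admissible 1 Q Q (λ t t<Q → subst (_≤ Q) (cong suc (sym (*-identityˡ t))) t<Q))

  gcdCoprimeTo-progression : ∀ M a t → gcdCoprimeTo M a (suc (M * t)) ≡ true
  gcdCoprimeTo-progression M a t = ⌊⌋≡true (g ≟ 1) (∣1⇒≡1 g∣1)
    where
    q = suc (M * t)
    g = gcd (gcd (∣P∣ a) q) M
    g∣q : g ∣ q
    g∣q = ∣-trans (gcd[m,n]∣m (gcd (∣P∣ a) q) M) (gcd[m,n]∣n (∣P∣ a) q)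
    g∣1 : g ∣ 1
    g∣1 = ∣m+n∣m⇒∣n (subst (g ∣_) (+-comm 1 (M * t)) g∣q) (ℕ.∣m⇒∣m*n t (gcd[m,n]∣n (gcd (∣P∣ a) q) M))

  column : ℕ → ℕ
  column q = ∑ (λ k → 𝟙 (coprimeP P (suc k) q)) q

  column+rest : ∀ q → column q + ∑ (λ k → 𝟙 (not (coprimeP P (suc k) q))) q ≡ q
  column+rest q = begin
    column q + ∑ (λ k → 𝟙 (not (coprimeP P (suc k) q))) q  ≡⟨ sym (∑-+ _ _ q) ⟩
    ∑ (λ k → 𝟙 (coprimeP P (suc k) q) + 𝟙 (not (coprimeP P (suc k) q))) q
                                                             ≡⟨ ∑-cong q (λ k _ → 𝟙+𝟙-not (coprimeP P (suc k) q)) ⟩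
    ∑ (λ _ → 1) q                                            ≡⟨ trans (∑-const 1 q) (*-identityʳ q) ⟩
    q                                                        ∎
    where
    open ≡-Reasoning
    𝟙+𝟙-not : ∀ b → 𝟙 b + 𝟙 (not b) ≡ 1
    𝟙+𝟙-not true  = refl
    𝟙+𝟙-not false = refl

  progression≤ : ∀ M z → Admissible M z → 1 ≤ M → ∀ Q T → M * T ≤ Q →
    ∑ (λ t → suc (M * t)) T ≤ countPairs (coprimeP P) Q + (deg * tailSum z Q T + deg * harmonic Q)
  progression≤ M z admissible M≥1 Q T MT≤Q = begin
    ∑ q T                                              ≡⟨ sym (∑-cong T (λ t _ → column+rest (q t))) ⟩
    ∑ (λ t → column (q t) + rest (q t)) T              ≡⟨ ∑-+ _ _ T ⟩
    ∑ (column ∘ q) T + ∑ (rest ∘ q) T                  ≤⟨ +-mono-≤ columns≤ rest≤ ⟩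
    countPairs (coprimeP P) Q + (deg * tailSum z Q T + deg * harmonic Q) ∎
    where
    open ≤-Reasoning
    q : ℕ → ℕ
    q t = suc (M * t)
    rest : ℕ → ℕ
    rest q = ∑ (λ k → 𝟙 (not (coprimeP P (suc k) q))) q
    q≤Q : ∀ t → t < T → q t ≤ Q
    q≤Q t t<T = ≤-trans (+-monoˡ-≤ (M * t) M≥1) (≤-trans (≤-reflexive (sym (*-suc M t))) (≤-trans (*-monoʳ-≤ M t<T) MT≤Q))
    columns≤ : ∑ (column ∘ q) T ≤ countPairs (coprimeP P) Q
    columns≤ = ≤-trans (∑-stride (column ∘ suc) M M≥1 T) (∑-monoˡ (column ∘ suc) MT≤Q)
    rest≤ : ∑ (rest ∘ q) T ≤ deg * tailSum z Q T + deg * harmonic Q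
    rest≤ = ≤-trans (≤-reflexive (∑-cong T (λ t _ → ∑-cong (q t) (λ k _ →
                      cong (λ b → 𝟙 (b ∧ not (coprimeP P (suc k) (q t)))) (sym (gcdCoprimeTo-progression M (suc k) t))))))
                    (bad-along M z admissible M Q T q≤Q)

module FinalArithmetic where

  open import Data.Nat using (_+_; _*_; >-nonZero)
  open import Data.Nat.Properties
  open import Data.Nat.Solver using (module +-*-Solver)
  open +-*-Solver using (solve; _:=_; _:+_; _:*_; con)
  open import Relation.Binary.PropositionalEquality using (refl)

  QT≤ : ∀ Q T N W H v M S → Q ≤ M * T + M → M * T * T ≤ 2 * S + M * T → M * T ≤ Q →
        S ≤ N + (v * W + v * H) → (4 * v + 1) * W ≤ Q * T → Q * T ≤ 4 * N + 4 * v * H + 4 * Q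
  QT≤ Q T N W H v M S Q≤ MTT≤ MT≤Q S≤ W≤ = +-cancelˡ-≤ (Q * T) _ _ (begin
    Q * T + Q * T                               ≡⟨ solve 2 (λ Q T → Q :* T :+ Q :* T := con 2 :* (Q :* T)) refl Q T ⟩
    2 * (Q * T)                                 ≤⟨ *-monoʳ-≤ 2 QT≤2S+2Q ⟩
    2 * (2 * S + 2 * Q)                         ≤⟨ *-monoʳ-≤ 2 (+-monoˡ-≤ (2 * Q) (*-monoʳ-≤ 2 S≤)) ⟩
    2 * (2 * (N + (v * W + v * H)) + 2 * Q)     ≡⟨ solve 5 (λ N v W H Q → con 2 :* (con 2 :* (N :+ (v :* W :+ v :* H)) :+ con 2 :* Q)
                                                                 := (con 4 :* v) :* W :+ (con 4 :* N :+ con 4 :* v :* H :+ con 4 :* Q)) refl N v W H Q ⟩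
    (4 * v) * W + (4 * N + 4 * v * H + 4 * Q)   ≤⟨ +-monoˡ-≤ _ (≤-trans (*-monoˡ-≤ W (m≤m+n (4 * v) 1)) W≤) ⟩
    Q * T + (4 * N + 4 * v * H + 4 * Q)         ∎)
    where
    open ≤-Reasoning
    QT≤2S+2Q : Q * T ≤ 2 * S + 2 * Q
    QT≤2S+2Q = begin
      Q * T              ≤⟨ *-monoˡ-≤ T Q≤ ⟩
      (M * T + M) * T    ≡⟨ solve 2 (λ M T → (M :* T :+ M) :* T := M :* T :* T :+ M :* T) refl M T ⟩
      M * T * T + M * T  ≤⟨ +-mono-≤ MTT≤ MT≤Q ⟩
      2 * S + M * T + Q  ≤⟨ +-monoˡ-≤ Q (+-monoʳ-≤ (2 * S) MT≤Q) ⟩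
      2 * S + Q + Q      ≡⟨ solve 2 (λ S Q → con 2 :* S :+ Q :+ Q := con 2 :* S :+ con 2 :* Q) refl S Q ⟩
      2 * S + 2 * Q      ∎

  Q²≤ : ∀ Q T N H v M → Q ≤ M * T + M → Q * T ≤ 4 * N + 4 * v * H + 4 * Q →
        Q * Q ≤ 4 * M * N + 4 * M * v * H + 5 * M * Q
  Q²≤ Q T N H v M Q≤ QT≤ = begin
    Q * Q                                   ≤⟨ *-monoʳ-≤ Q Q≤ ⟩
    Q * (M * T + M)                         ≡⟨ solve 3 (λ Q M T → Q :* (M :* T :+ M) := M :* (Q :* T) :+ M :* Q) refl Q M T ⟩
    M * (Q * T) + M * Q                     ≤⟨ +-monoˡ-≤ (M * Q) (*-monoʳ-≤ M QT≤) ⟩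
    M * (4 * N + 4 * v * H + 4 * Q) + M * Q ≡⟨ solve 5 (λ M N v H Q → M :* (con 4 :* N :+ con 4 :* v :* H :+ con 4 :* Q) :+ M :* Q
                                                                 := con 4 :* M :* N :+ con 4 :* M :* v :* H :+ con 5 :* M :* Q) refl M N v H Q ⟩
    4 * M * N + 4 * M * v * H + 5 * M * Q   ∎
    where open ≤-Reasoning

  lowerOrder≤Q² : ∀ Q H M v e L → let K = 16 * M * v * (1 + e) in
    K * H ≤ K * K * Q + Q * Q → K * K + 20 * M + 48 * M * e * L ≤ Q →
    8 * M * v * (1 + e) * H + 24 * M * e * L * Q + 10 * M * Q ≤ Q * Q
  lowerOrder≤Q² Q H M v e L KH≤ Q-large = *-cancelˡ-≤ 2 (begin
    2 * (8 * M * v * (1 + e) * H + 24 * M * e * L * Q + 10 * M * Q)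
      ≡⟨ solve 6 (λ M v e H L Q → con 2 :* (con 8 :* M :* v :* (con 1 :+ e) :* H :+ con 24 :* M :* e :* L :* Q :+ con 10 :* M :* Q)
                                 := con 16 :* M :* v :* (con 1 :+ e) :* H :+ (con 48 :* M :* e :* L :* Q :+ con 20 :* M :* Q)) refl M v e H L Q ⟩
    K * H + (48 * M * e * L * Q + 20 * M * Q)
      ≤⟨ +-monoˡ-≤ _ KH≤ ⟩
    K * K * Q + Q * Q + (48 * M * e * L * Q + 20 * M * Q)
      ≡⟨ solve 5 (λ k Q M e L → k :* k :* Q :+ Q :* Q :+ (con 48 :* M :* e :* L :* Q :+ con 20 :* M :* Q)
                               := Q :* (k :* k :+ con 20 :* M :+ con 48 :* M :* e :* L) :+ Q :* Q) refl K Q M e L ⟩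
    Q * (K * K + 20 * M + 48 * M * e * L) + Q * Q
      ≤⟨ +-monoˡ-≤ _ (*-monoʳ-≤ Q Q-large) ⟩
    Q * Q + Q * Q
      ≡⟨ solve 1 (λ Q → Q :* Q :+ Q :* Q := con 2 :* (Q :* Q)) refl Q ⟩
    2 * (Q * Q) ∎)
    where
    open ≤-Reasoning
    K = 16 * M * v * (1 + e)

  -- Both sides are multiplied by 8M and 8MvH + 10MQ is added, so that Q² ≤ 4MN + 4MvH + 5MQ can be used twice.
  error≤N : ∀ Q N B H W M e v L → 1 ≤ M →
    Q * Q ≤ 4 * M * N + 4 * M * v * H + 5 * M * Q →
    8 * M * e * v * W ≤ Q * Q →
    B ≤ v * W + v * H →
    8 * M * v * (1 + e) * H + 24 * M * e * L * Q + 10 * M * Q ≤ Q * Q →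
    e * (B + 3 * L * Q) ≤ N
  error≤N Q N B H W M e v L M≥1 Q²≤ W≤ B≤ lowerOrder≤ =
    *-cancelˡ-≤ (8 * M) {{>-nonZero (≤-trans M≥1 (m≤n*m M 8))}} (+-cancelʳ-≤ X _ _ (begin
    8 * M * (e * (B + 3 * L * Q)) + X
      ≡⟨ solve 8 (λ M e B L Q v H N → con 8 :* M :* (e :* (B :+ con 3 :* L :* Q)) :+ (con 8 :* M :* v :* H :+ con 10 :* M :* Q)
                                     := con 8 :* M :* (e :* B) :+ (con 24 :* M :* e :* L :* Q :+ con 8 :* M :* v :* H :+ con 10 :* M :* Q)) refl M e B L Q v H N ⟩
    8 * M * (e * B) + (24 * M * e * L * Q + 8 * M * v * H + 10 * M * Q)
      ≤⟨ +-monoˡ-≤ _ 8MeB≤ ⟩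
    Q * Q + 8 * M * e * v * H + (24 * M * e * L * Q + 8 * M * v * H + 10 * M * Q)
      ≡⟨ solve 6 (λ Q M e v H L → Q :* Q :+ con 8 :* M :* e :* v :* H :+ (con 24 :* M :* e :* L :* Q :+ con 8 :* M :* v :* H :+ con 10 :* M :* Q)
                                 := Q :* Q :+ (con 8 :* M :* v :* (con 1 :+ e) :* H :+ con 24 :* M :* e :* L :* Q :+ con 10 :* M :* Q)) refl Q M e v H L ⟩
    Q * Q + (8 * M * v * (1 + e) * H + 24 * M * e * L * Q + 10 * M * Q)
      ≤⟨ +-monoʳ-≤ (Q * Q) lowerOrder≤ ⟩
    Q * Q + Q * Q
      ≤⟨ +-mono-≤ Q²≤ Q²≤ ⟩
    (4 * M * N + 4 * M * v * H + 5 * M * Q) + (4 * M * N + 4 * M * v * H + 5 * M * Q)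
      ≡⟨ solve 5 (λ M N v H Q → (con 4 :* M :* N :+ con 4 :* M :* v :* H :+ con 5 :* M :* Q) :+ (con 4 :* M :* N :+ con 4 :* M :* v :* H :+ con 5 :* M :* Q)
                               := con 8 :* M :* N :+ (con 8 :* M :* v :* H :+ con 10 :* M :* Q)) refl M N v H Q ⟩
    8 * M * N + X ∎))
    where
    open ≤-Reasoning
    X = 8 * M * v * H + 10 * M * Q
    8MeB≤ : 8 * M * (e * B) ≤ Q * Q + 8 * M * e * v * H
    8MeB≤ = begin
      8 * M * (e * B)                          ≤⟨ *-monoʳ-≤ (8 * M) (*-monoʳ-≤ e B≤) ⟩
      8 * M * (e * (v * W + v * H))            ≡⟨ solve 5 (λ M e v W H → con 8 :* M :* (e :* (v :* W :+ v :* H))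
                                                                    := con 8 :* M :* e :* v :* W :+ con 8 :* M :* e :* v :* H) refl M e v W H ⟩
      8 * M * e * v * W + 8 * M * e * v * H    ≤⟨ +-monoˡ-≤ _ W≤ ⟩
      Q * Q + 8 * M * e * v * H                ∎

module Rationals where

  open import Data.Nat using (suc; _+_; _*_)
  open import Data.Nat.Properties
  open import Data.Nat.Coprimality using (Coprime)
  open import Data.Integer as ℤ using (+_; +≤+)
  import Data.Integer.Properties as ℤ
  open import Data.Integer.Solver using (module +-*-Solver)
  open +-*-Solver using (solve; _:=_; _:+_; _:*_; _:-_; :-_)
  open import Data.Rational as ℚ using (mkℚ)
  import Data.Rational.Properties as ℚ
  open import Data.Rational.Unnormalised as ℚᵘ using (mkℚᵘ; *≤*)
  import Data.Rational.Unnormalised.Properties as ℚᵘ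
  open import Data.Sum using (inj₁; inj₂)
  open import Relation.Binary.PropositionalEquality
    using (_≡_; refl; sym; trans; cong; cong₂; subst; subst₂; module ≡-Reasoning)

  toℚᵘ-/ : ∀ a q → ℚ.toℚᵘ (+ a ℚ./ suc q) ℚᵘ.≃ mkℚᵘ (+ a) q
  toℚᵘ-/ a q = ℚ.toℚᵘ-fromℚᵘ (mkℚᵘ (+ a) q)

  a/q≤n/d⇒ : ∀ a q n d .(c : Coprime n (suc d)) → + a ℚ./ suc q ℚ.≤ mkℚ (+ n) d c → a * suc d ≤ n * suc q
  a/q≤n/d⇒ a q n d c a/q≤n/d with ℚᵘ.≤-respˡ-≃ (toℚᵘ-/ a q) (ℚ.toℚᵘ-mono-≤ a/q≤n/d)
  ... | *≤* ad≤nq = ℤ.drop‿+≤+ (subst₂ ℤ._≤_ (sym (ℤ.pos-* a (suc d))) (sym (ℤ.pos-* n (suc q))) ad≤nq)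

  ⇒a/q≤n/d : ∀ a q n d .(c : Coprime n (suc d)) → a * suc d ≤ n * suc q → + a ℚ./ suc q ℚ.≤ mkℚ (+ n) d c
  ⇒a/q≤n/d a q n d c ad≤nq = ℚ.toℚᵘ-cancel-≤ (ℚᵘ.≤-respˡ-≃ (ℚᵘ.≃-sym (toℚᵘ-/ a q))
    (*≤* (subst₂ ℤ._≤_ (ℤ.pos-* a (suc d)) (ℤ.pos-* n (suc q)) (+≤+ ad≤nq))))

  n/d≤1⇒n≤d : ∀ n d .(c : Coprime n (suc d)) → mkℚ (+ n) d c ℚ.≤ ℚ.1ℚ → n ≤ suc d
  n/d≤1⇒n≤d n d c (ℚ.*≤* n≤d) = ℤ.drop‿+≤+ (subst₂ ℤ._≤_ (ℤ.*-identityʳ (+ n)) (ℤ.*-identityˡ (+ suc d)) n≤d)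

  ∣m-n∣≤ : ∀ m n k → m ≤ n + k → n ≤ m + k → ℤ.∣ + m ℤ.- + n ∣ ≤ k
  ∣m-n∣≤ m n k m≤n+k n≤m+k with ≤-total m n
  ... | inj₁ m≤n = subst (_≤ k) (sym (trans (cong ℤ.∣_∣ (ℤ.m-n≡m⊖n m n)) (ℤ.∣⊖∣-≤ m≤n))) (m≤n+o⇒m∸n≤o n m n≤m+k)
  ... | inj₂ n≤m = subst (_≤ k) (sym (trans (cong ℤ.∣_∣ (ℤ.m-n≡m⊖n m n)) (trans (ℤ.∣m⊖n∣≡∣n⊖m∣ m n) (ℤ.∣⊖∣-≤ n≤m))))
                         (m≤n+o⇒m∸n≤o m n m≤n+k)

  ∣k*m-k*n∣ : ∀ k m n → ℤ.∣ + (k * m) ℤ.- + (k * n) ∣ ≡ k * ℤ.∣ + m ℤ.- + n ∣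
  ∣k*m-k*n∣ k m n = trans (cong ℤ.∣_∣ factor) (ℤ.abs-* (+ k) (+ m ℤ.- + n))
    where
    factor : + (k * m) ℤ.- + (k * n) ≡ + k ℤ.* (+ m ℤ.- + n)
    factor = trans (cong₂ ℤ._-_ (ℤ.pos-* k m) (ℤ.pos-* k n))
                   (solve 3 (λ k m n → k :* m :- k :* n := k :* (m :- n)) refl (+ k) (+ m) (+ n))

  -- The hypotheses say (e + 1)·∣A(d + 1) − nN∣ ≤ (d + 1)N, so ∣A/N − n/(d + 1)∣ ≤ 1/(e + 1) ≤ (e₁ + 1)/(e + 1).
  ∣A/N-n/d∣≤ : ∀ A N n d e₁ e .(c : Coprime n (suc d)) .(c′ : Coprime (suc e₁) (suc e)) → 1 ≤ N →
    suc e * (A * suc d) ≤ suc e * (n * N) + suc d * N →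
    suc e * (n * N) ≤ suc e * (A * suc d) + suc d * N →
    ℚ.∣ ratio A N ℚ.- mkℚ (+ n) d c ∣ ℚ.≤ mkℚ (+ suc e₁) e c′
  ∣A/N-n/d∣≤ A (suc N) n d e₁ e c c′ _ upper lower =
    ℚ.toℚᵘ-cancel-≤ (ℚᵘ.≤-respˡ-≃ (ℚᵘ.≃-sym toℚᵘ-∣A/N-n/d∣)
      (*≤* (subst₂ ℤ._≤_ (ℤ.pos-* ℤ.∣ numerator ∣ (suc e)) (ℤ.pos-* (suc e₁) (suc N * suc d)) (+≤+ numerator≤))))
    where
    A/N = + A ℚ./ suc N
    n/d = mkℚ (+ n) d c
    toℚᵘ-∣A/N-n/d∣ : ℚ.toℚᵘ ℚ.∣ A/N ℚ.- n/d ∣ ℚᵘ.≃ ℚᵘ.∣ mkℚᵘ (+ A) N ℚᵘ.+ ℚᵘ.- mkℚᵘ (+ n) d ∣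
    toℚᵘ-∣A/N-n/d∣ = ℚᵘ.≃-trans (ℚ.toℚᵘ-homo-∣-∣ (A/N ℚ.- n/d))
                       (ℚᵘ.∣-∣-cong (ℚᵘ.≃-trans (ℚ.toℚᵘ-homo-+ A/N (ℚ.- n/d)) (ℚᵘ.+-cong (toℚᵘ-/ A N) (ℚ.toℚᵘ-homo‿- n/d))))
    numerator = + A ℤ.* + suc d ℤ.+ (ℤ.- + n) ℤ.* + suc N
    numerator≡ : numerator ≡ + (A * suc d) ℤ.- + (n * suc N)
    numerator≡ = trans (solve 4 (λ a d n m → a :* d :+ (:- n) :* m := a :* d :- n :* m) refl (+ A) (+ suc d) (+ n) (+ suc N))
                       (cong₂ ℤ._-_ (sym (ℤ.pos-* A (suc d))) (sym (ℤ.pos-* n (suc N))))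
    numerator≤ : ℤ.∣ numerator ∣ * suc e ≤ suc e₁ * (suc N * suc d)
    numerator≤ = begin
      ℤ.∣ numerator ∣ * suc e                                    ≡⟨ *-comm _ (suc e) ⟩
      suc e * ℤ.∣ numerator ∣                                    ≡⟨ cong (λ x → suc e * ℤ.∣ x ∣) numerator≡ ⟩
      suc e * ℤ.∣ + (A * suc d) ℤ.- + (n * suc N) ∣              ≡⟨ sym (∣k*m-k*n∣ (suc e) (A * suc d) (n * suc N)) ⟩
      ℤ.∣ + (suc e * (A * suc d)) ℤ.- + (suc e * (n * suc N)) ∣  ≤⟨ ∣m-n∣≤ _ _ _ upper lower ⟩
      suc d * suc N                                              ≡⟨ *-comm (suc d) (suc N) ⟩
      suc N * suc d                                              ≤⟨ m≤m+n (suc N * suc d) _ ⟩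
      suc e₁ * (suc N * suc d)                                   ∎
      where open ≤-Reasoning

module LocalDiscrepancy {ν : ℕ} (c : Fin ν → ℤ) (j : Fin ν) (cⱼ≢0 : c j ≢ 0ℤ) (e : ℕ) where

  open import Data.Nat using (zero; suc; _+_; _*_; _<_; _<?_; _/_; _!; z≤n; s≤s; NonZero; >-nonZero; >-nonZero⁻¹)
  open import Data.Nat.Properties
  open import Data.Nat.Divisibility using (∣m⇒∣m*n; ∣n⇒∣m*n)
  open import Data.Nat.Solver using (module +-*-Solver)
  open +-*-Solver using (solve; _:=_; _:+_; _:*_)
  open import Data.Nat.Coprimality using (Coprime)
  open import Data.Nat.Primality using (prime⇒nonZero)
  open import Data.Integer as ℤ using (+_; -[1+_])
  import Data.Integer.Divisibility.Signed as ℤ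
  open import Data.Rational as ℚ using (mkℚ)
  import Data.Rational.Properties as ℚ
  open import Data.List.Properties using (map-tabulate)
  open import Data.List.Relation.Unary.Any using (Any; there)
  open import Data.List.Relation.Unary.Any.Properties using (tabulate⁺)
  open import Data.Bool using (Bool; _∧_)
  open import Data.Product using (_,_)
  open import Data.Empty using (⊥-elim)
  open import Relation.Nullary using (¬_; yes; no)
  open import Relation.Nullary.Decidable using (⌊_⌋)
  open import Relation.Binary.PropositionalEquality using (refl; sym; cong; subst; subst₂)
  open Sums
  open Arithmetic
  open PairCounting
  open Estimates
  open FinalArithmetic
  open Rationals
  open Sieve (poly c)

  P : Poly
  P = poly c

  E C : ℕ
  E = suc e
  C = ℤ.∣ c j ∣

  C≥1 : 1 ≤ C
  C≥1 = ∣i∣≥1 (c j) cⱼ≢0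
    where
    ∣i∣≥1 : ∀ i → i ≢ 0ℤ → 1 ≤ ℤ.∣ i ∣
    ∣i∣≥1 (+ zero)   i≢0 = ⊥-elim (i≢0 refl)
    ∣i∣≥1 (+ suc _)  _   = s≤s z≤n
    ∣i∣≥1 -[1+ _ ]   _   = s≤s z≤n

  admissible : ∀ n → Admissible (n ! * C) n
  admissible n p p-prime p∤n!C = n<p , there (subst (Any _) (sym (map-tabulate (λ i → i) c)) (tabulate⁺ j p∤cⱼ))
    where
    n<p : n < p
    n<p with n <? p
    ... | yes n<p = n<p
    ... | no  n≮p = ⊥-elim (p∤n!C (∣m⇒∣m*n C (m∣n! (>-nonZero⁻¹ p {{prime⇒nonZero p-prime}}) (≮⇒≥ n≮p))))
    p∤cⱼ : ¬ (+ p ℤ.∣ c j)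
    p∤cⱼ p∣cⱼ = p∤n!C (∣n⇒∣m*n (n !) (ℤ.∣⇒∣ᵤ p∣cⱼ))

  -- The moduli q = 1 + Mt ≤ Q contribute about QT/2 pairs, of which the sieve removes at most
  -- deg · QT/p₀ < QT/4, so 𝒩 ≳ QT/4 ≈ Q²/(4M); the pairs that are L-good but not coprime
  -- number about deg · Q²/z < Q²/(8ME). Q₀ absorbs the O(LQ) and O(Q log Q) terms.
  p₀ M z L K Q₀ : ℕ
  p₀ = 4 * deg + 1
  M  = p₀ ! * C
  z  = 8 * M * E * deg + 1
  L  = z ! * C
  K  = 16 * M * deg * (1 + E)
  Q₀ = K * K + 20 * M + 48 * M * E * L + 1

  M≥1 : 1 ≤ M
  M≥1 = *-mono-≤ (1≤n! p₀) C≥1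

  instance
    M≢0 : NonZero M
    M≢0 = >-nonZero M≥1
    L≢0 : NonZero L
    L≢0 = >-nonZero (*-mono-≤ (1≤n! z) C≥1)

  module _ (Q : ℕ) (Q₀≤Q : Q₀ ≤ Q) where

    T N B : ℕ
    T = Q / M
    N = countPairs (coprimeP P) Q
    B = countPairs (bad L) Q

    N-large : E * (B + 3 * L * Q) ≤ N
    N-large = error≤N Q N B (harmonic Q) (tailSum z Q Q) M E deg L M≥1 Q²-bound W-bound B-bound lowerOrder-bound
      where
      QT-bound : Q * T ≤ 4 * N + 4 * deg * harmonic Q + 4 * Q
      QT-bound = QT≤ Q T N (tailSum p₀ Q T) (harmonic Q) deg M (∑ (λ t → suc (M * t)) T)
                   (m≤n*[m/n]+n Q M) (progression-sum M T) (n*[m/n]≤m Q M)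
                   (progression≤ M p₀ (admissible p₀) M≥1 Q T (n*[m/n]≤m Q M)) (z*tailSum≤ p₀ Q T (m≤n+m 1 _))
      Q²-bound = Q²≤ Q T N (harmonic Q) deg M (m≤n*[m/n]+n Q M) QT-bound
      W-bound : 8 * M * E * deg * tailSum z Q Q ≤ Q * Q
      W-bound = ≤-trans (*-monoˡ-≤ (tailSum z Q Q) (m≤m+n (8 * M * E * deg) 1)) (z*tailSum≤ z Q Q (m≤n+m 1 _))
      B-bound = bad-total≤ L z (admissible z) Q
      lowerOrder-bound = lowerOrder≤Q² Q (harmonic Q) M deg E L (K*harmonic≤ K Q) (≤-trans (m≤m+n _ 1) Q₀≤Q)

    N≥1 : 1 ≤ N
    N≥1 = ≤-trans (*-mono-≤ (*-mono-≤ (s≤s {0} {2} z≤n) (*-mono-≤ (1≤n! z) C≥1)) (≤-trans (m≤n+m 1 _) Q₀≤Q))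
                  (≤-trans (m≤n+m _ B) (≤-trans (m≤n*m _ E) N-large))

    module _ (n d : ℕ) .(cα : Coprime n (suc d)) (n≤d : n ≤ suc d) where

      α : ℚ
      α = mkℚ (+ n) d cα

      ≤α? : ℕ → ℕ → Bool
      ≤α? a q = ⌊ val (a , q) ℚ.≤? α ⌋

      open Splitting.Discrepancy (coprimeP P) (gcdCoprimeTo L) ≤α? (coprimeP⇒gcdCoprimeTo L) n (suc d) n≤d
        (λ a i a/q≤α → a/q≤n/d⇒ a i n d cα (⌊⌋≡true⇒ (_ ℚ.≤? α) a/q≤α))
        (λ a i ad≤nq → ⌊⌋≡true (_ ℚ.≤? α) (⇒a/q≤n/d a i n d cα ad≤nq))
        L (gcdCoprimeTo-periodic L)
        using (total-upper; total-lower)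

      A≤ : ℕ
      A≤ = countPairs (λ a q → coprimeP P a q ∧ ≤α? a q) Q

      upper : E * (A≤ * suc d) ≤ E * (n * N) + suc d * N
      upper = begin
        E * (A≤ * suc d)                        ≡⟨ cong (E *_) (*-comm A≤ (suc d)) ⟩
        E * (suc d * A≤)                        ≤⟨ *-monoʳ-≤ E (total-upper Q) ⟩
        E * (n * N + suc d * (B + 3 * L * Q))   ≡⟨ solve 5 (λ E n N d X → E :* (n :* N :+ d :* X) := E :* (n :* N) :+ d :* (E :* X)) refl E n N (suc d) (B + 3 * L * Q) ⟩
        E * (n * N) + suc d * (E * (B + 3 * L * Q)) ≤⟨ +-monoʳ-≤ (E * (n * N)) (*-monoʳ-≤ (suc d) N-large) ⟩
        E * (n * N) + suc d * N                 ∎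
        where open ≤-Reasoning

      lower : E * (n * N) ≤ E * (A≤ * suc d) + suc d * N
      lower = begin
        E * (n * N)                                  ≤⟨ *-monoʳ-≤ E (total-lower Q) ⟩
        E * (suc d * A≤ + suc d * (B + 3 * L * Q))   ≡⟨ solve 4 (λ E A d X → E :* (d :* A :+ d :* X) := E :* (A :* d) :+ d :* (E :* X)) refl E A≤ (suc d) (B + 3 * L * Q) ⟩
        E * (A≤ * suc d) + suc d * (E * (B + 3 * L * Q)) ≤⟨ +-monoʳ-≤ (E * (A≤ * suc d)) (*-monoʳ-≤ (suc d) N-large) ⟩
        E * (A≤ * suc d) + suc d * N                 ∎
        where open ≤-Reasoning

      localDisc-n/d≤ : ∀ e₁ .(c′ : Coprime (suc e₁) E) → localDisc P Q α ℚ.≤ mkℚ (+ suc e₁) e c′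
      localDisc-n/d≤ e₁ c′ = subst₂ (λ a b → ℚ.∣ ratio a b ℚ.- α ∣ ℚ.≤ mkℚ (+ suc e₁) e c′)
        (sym (countIf-pairs _ Q)) (sym (countIf-pairs _ Q)) (∣A/N-n/d∣≤ A≤ N n d e₁ e cα c′ N≥1 upper lower)

  localDisc≤ : ∀ e₁ .(c′ : Coprime (suc e₁) E) → ∀ Q → Q₀ ≤ Q →
               ∀ α → ℚ.0ℚ ℚ.≤ α → α ℚ.≤ ℚ.1ℚ → localDisc P Q α ℚ.≤ mkℚ (+ suc e₁) e c′
  localDisc≤ e₁ c′ Q Q₀≤Q (mkℚ (+ n) d cα)    _          α≤1 = localDisc-n/d≤ Q Q₀≤Q n d cα (n/d≤1⇒n≤d n d cα α≤1) e₁ c′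
  localDisc≤ e₁ c′ Q Q₀≤Q (mkℚ -[1+ _ ] _ _) (ℚ.*≤* ()) _

corollary1p2 : (ν : ℕ) → 2 ≤ ν → (c : Fin ν → ℤ) → (∃[ i ] c i ≢ 0ℤ) →
    discriminant (poly c) ≢ 0ℤ →
    (ε : ℚ) → 0ℚ <ℚ ε →
    ∃[ Q₀ ] ((Q : ℕ) → Q₀ ≤ Q →
    (α : ℚ) → 0ℚ ≤ℚ α → α ≤ℚ 1ℚ → localDisc (poly c) Q α ≤ℚ ε)
corollary1p2 _ _ c (j , cⱼ≢0) _ (mkℚ +[1+ e₁ ] e c′) _ =
  LocalDiscrepancy.Q₀ c j cⱼ≢0 e , LocalDiscrepancy.localDisc≤ c j cⱼ≢0 e e₁ c′
corollary1p2 _ _ _ _ _ (mkℚ +0 _ _)       (*<* (+<+ ()))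
corollary1p2 _ _ _ _ _ (mkℚ -[1+ _ ] _ _) (*<* ())
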